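{- Let $k \geq 2$ and let $G$ be a graph on $n \geq 4k$ vertices with $\sigma_2(G) \geq 6k-2$ such that $G$ does not contain $k$ vertex-disjoint chorded cycles, but $G + e$ does for every $e \in E(\overline{G})$. Let $\mathcal C$ be a collection of $k-1$ vertex-disjoint chorded cycles of $G$ chosen so that (O1) the total number of vertices in the cycles of $\mathcal C$ is minimum; (O2) subject to (O1), the total number of chords is maximum; (O3) subject to (O1) and (O2), the number of vertices of a longest path in $R := G - \bigcup_{C \in \mathcal C} V(C)$ is maximum. Let $Q$ be a path in $R$ with $|Q| \geq 4$ and let $C \in \mathcal C$. If $F \subseteq V(Q)$ with $|F| = 4$, then $\|F, C\| \leq 12$. Furthermore, if $G[V(C)] \cong K_4$ and some endpoint $v$ of $Q$ satisfies $\|v,C\| \geq 3$, then $\|V(Q), C\| \leq 12$, with $\|V(Q),C\| = 12$ only if $\|v,C\| = 4$.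
   Context: All graphs are finite and simple. $\sigma_2(G) := \min\{d_G(x)+d_G(y) : x \neq y,\ xy \notin E(G)\}$. A chorded cycle is a cycle together with at least one chord (an edge of $G$ joining two non-consecutive vertices of the cycle). $|Q|$, $|C|$ denote numbers of vertices. For $A,B \subseteq V(G)$, $\|A,B\| := \sum_{a\in A}|N_G(a)\cap B|$, with a vertex or subgraph identified with its (vertex) set. -}

module Defs where

open import Data.Nat using (ℕ; zero; suc; _+_; _*_; _∸_; _≤_; _<ᵇ_; _≡ᵇ_)
open import Data.Bool using (Bool; true; false; _∨_; _∧_; not; if_then_else_)
open import Data.Fin using (Fin; toℕ; _≟_)
open import Data.List using (List; map; allFin; length)
open import Data.Nat.ListAction using (sum)
open import Data.List.Membership.Propositional using (_∈_)
open import Data.List.Relation.Unary.All using (All)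
open import Data.List.Relation.Unary.AllPairs using (AllPairs)
open import Data.List.Relation.Unary.Unique.Propositional using (Unique)
open import Data.Product using (Σ; ∃; ∃-syntax; _×_; _,_)
open import Data.Sum using (_⊎_)
open import Function.Definitions using (Injective)
open import Relation.Nullary using (¬_)
open import Relation.Nullary.Decidable using (⌊_⌋)
open import Relation.Binary.PropositionalEquality using (_≡_; _≢_)

-- A graph on vertex set Fin n is given by a Bool-valued adjacency function;
-- simplicity (symmetric, loopless) is assumed as hypotheses in the theorem.
Adjacency : ℕ → Set
Adjacency n = Fin n → Fin n → Bool

ΣFin : (m : ℕ) → (Fin m → ℕ) → ℕ
ΣFin m f = sum (map f (allFin m))

b2n : Bool → ℕ
b2n true = 1
b2n false = 0

deg : ∀ {n} → Adjacency n → Fin n → ℕ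
deg {n} adj x = ΣFin n (λ y → b2n (adj x y))

addEdge : ∀ {n} → Adjacency n → Fin n → Fin n → Adjacency n
addEdge adj x y a b =
  adj a b ∨ ((⌊ a ≟ x ⌋ ∧ ⌊ b ≟ y ⌋) ∨ (⌊ a ≟ y ⌋ ∧ ⌊ b ≟ x ⌋))

consecB : ℕ → ℕ → ℕ → Bool
consecB m i j =
  (suc i ≡ᵇ j) ∨ (suc j ≡ᵇ i) ∨ ((i ≡ᵇ 0) ∧ (suc j ≡ᵇ m)) ∨ ((j ≡ᵇ 0) ∧ (suc i ≡ᵇ m))

record Cycle {n : ℕ} (adj : Adjacency n) : Set where
  field
    len   : ℕ
    vert  : Fin len → Fin n
    len≥3 : 3 ≤ len
    inj   : Injective _≡_ _≡_ vert
    edges : ∀ (i j : Fin len) → consecB len (toℕ i) (toℕ j) ≡ true → adj (vert i) (vert j) ≡ true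

open Cycle public

IsChord : ∀ {n} {adj : Adjacency n} (C : Cycle adj) → Fin (len C) → Fin (len C) → Set
IsChord {adj = adj} C i j =
  toℕ i ≢ toℕ j × consecB (len C) (toℕ i) (toℕ j) ≡ false × adj (vert C i) (vert C j) ≡ true

numChords : ∀ {n} {adj : Adjacency n} → Cycle adj → ℕ
numChords {adj = adj} C =
  ΣFin (len C) (λ i → ΣFin (len C) (λ j →
    b2n ((toℕ i <ᵇ toℕ j) ∧ not (consecB (len C) (toℕ i) (toℕ j)) ∧ adj (vert C i) (vert C j))))

record ChordedCycle {n : ℕ} (adj : Adjacency n) : Set where
  field
    cyc   : Cycle adj
    chord : ∃[ i ] ∃[ j ] IsChord cyc i j

open ChordedCycle public

_∈V_ : ∀ {n} {adj : Adjacency n} → Fin n → ChordedCycle adj → Set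
x ∈V C = ∃[ i ] vert (cyc C) i ≡ x

VDisjoint : ∀ {n} {adj : Adjacency n} → ChordedCycle adj → ChordedCycle adj → Set
VDisjoint C D = ∀ x → x ∈V C → ¬ (x ∈V D)

record Collection {n : ℕ} (adj : Adjacency n) (k : ℕ) : Set where
  field
    cycles   : List (ChordedCycle adj)
    size     : length cycles ≡ k
    disjoint : AllPairs VDisjoint cycles

open Collection public

HasDisjointChordedCycles : ∀ {n} → Adjacency n → ℕ → Set
HasDisjointChordedCycles adj k = Collection adj k

totalVerts : ∀ {n} {adj : Adjacency n} {k} → Collection adj k → ℕ
totalVerts 𝒞 = sum (map (λ C → len (cyc C)) (cycles 𝒞))

totalChords : ∀ {n} {adj : Adjacency n} {k} → Collection adj k → ℕ
totalChords 𝒞 = sum (map (λ C → numChords (cyc C)) (cycles 𝒞))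

Covered : ∀ {n} {adj : Adjacency n} {k} → Collection adj k → Fin n → Set
Covered 𝒞 x = ∃[ C ] (C ∈ cycles 𝒞 × x ∈V C)

record Path {n : ℕ} (adj : Adjacency n) : Set where
  field
    plen   : ℕ
    pvert  : Fin plen → Fin n
    pinj   : Injective _≡_ _≡_ pvert
    pedges : ∀ (i j : Fin plen) → suc (toℕ i) ≡ toℕ j → adj (pvert i) (pvert j) ≡ true

open Path public

-- Q is a path of R = G - ⋃ V(C), C ∈ 𝒞
PathIn : ∀ {n} {adj : Adjacency n} {k} → Collection adj k → Path adj → Set
PathIn 𝒞 Q = ∀ i → ¬ Covered 𝒞 (pvert Q i)

_∈P_ : ∀ {n} {adj : Adjacency n} → Fin n → Path adj → Set
x ∈P Q = ∃[ i ] pvert Q i ≡ x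

Endpoint : ∀ {n} {adj : Adjacency n} → Path adj → Fin n → Set
Endpoint Q v = ∃[ i ] ((toℕ i ≡ 0 ⊎ suc (toℕ i) ≡ plen Q) × pvert Q i ≡ v)

edgesTo : ∀ {n} {adj : Adjacency n} → Fin n → ChordedCycle adj → ℕ
edgesTo {adj = adj} x C = ΣFin (len (cyc C)) (λ i → b2n (adj x (vert (cyc C) i)))

-- ‖F, C‖ for F a list of distinct vertices
edgesSet : ∀ {n} {adj : Adjacency n} → List (Fin n) → ChordedCycle adj → ℕ
edgesSet F C = sum (map (λ x → edgesTo x C) F)

edgesPath : ∀ {n} {adj : Adjacency n} → Path adj → ChordedCycle adj → ℕ
edgesPath Q C = ΣFin (plen Q) (λ i → edgesTo (pvert Q i) C)

InducesK4 : ∀ {n} {adj : Adjacency n} → ChordedCycle adj → Set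
InducesK4 {adj = adj} C =
  len (cyc C) ≡ 4 × (∀ i j → i ≢ j → adj (vert (cyc C) i) (vert (cyc C) j) ≡ true)

Sigma2≥ : ∀ {n} → Adjacency n → ℕ → Set
Sigma2≥ adj s = ∀ x y → x ≢ y → adj x y ≡ false → s ≤ deg adj x + deg adj y

O1 : ∀ {n} {adj : Adjacency n} {m} → Collection adj m → Set
O1 {adj = adj} {m} 𝒞 = ∀ (𝒟 : Collection adj m) → totalVerts 𝒞 ≤ totalVerts 𝒟

O2 : ∀ {n} {adj : Adjacency n} {m} → Collection adj m → Set
O2 {adj = adj} {m} 𝒞 = ∀ (𝒟 : Collection adj m) →
  totalVerts 𝒟 ≡ totalVerts 𝒞 → totalChords 𝒟 ≤ totalChords 𝒞

O3 : ∀ {n} {adj : Adjacency n} {m} → Collection adj m → Set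
O3 {adj = adj} {m} 𝒞 = ∀ (𝒟 : Collection adj m) →
  totalVerts 𝒟 ≡ totalVerts 𝒞 → totalChords 𝒟 ≡ totalChords 𝒞 →
  ∀ (P : Path adj) → PathIn 𝒟 P → ∃[ P' ] (PathIn 𝒞 P' × plen P ≤ plen P')

module Submission where

-- Only two consequences of the hypotheses are
-- used: (swap) no two vertex-disjoint chorded cycles live inside V(C) ∪ V(Q), since
-- together with 𝒞 - C they would give k disjoint chorded cycles; and (O1) no chorded
-- cycle inside V(C) ∪ V(Q) is shorter than C.
--   Part 1.  If |C| ≥ 5, a vertex x of Q with four neighbours c₁ < c₂ < c₃ < c₄ on C yields
-- a shorter chorded cycle (x with the arc c₁…c₃ and chord xc₂, or the 4-cycle x c₃ c₄ c₁
-- with chord xc₄), so ‖x, C‖ ≤ 3 and ‖F, C‖ ≤ 12.  If |C| = 4 = c₀c₁c₂c₃, sort F along Q as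
-- f₁ < f₂ < f₃ < f₄: if {f₁,f₂} sends ≥ 3 edges to the edge c₀c₁ and {f₃,f₄} sends ≥ 3 edges
-- to c₂c₃, the two segments of Q with these edges give two disjoint chorded cycles; the
-- same holds with the edges exchanged, and counting gives ‖F, C‖ ≤ 12.
--   Part 2.  If C ≅ K₄ and the endpoint v sees ≥ 3 vertices of C, then for each c ∈ C the
-- vertex v spans a chorded cycle with C - c, so c has ≤ 2 neighbours on the path Q - v
-- (three would close Q - v into a second chorded cycle); hence ‖V(Q), C‖ ≤ 4 + 4·2.
--   The file first proves generic facts (booleans, sums, lists, sorting four positions),
-- then constructions of chorded cycles from paths (fan closing) for any graph, then
-- fixes the setting of the lemma and derives the two parts.

open import Defs
open import Data.Nat using (ℕ; zero; suc; _+_; _*_; _∸_; _≤_; _<_; _≥_; z≤n; s≤s; _≡ᵇ_; _<?_; _≤?_; _≟_)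
open import Data.Nat.Properties
open import Data.Nat.ListAction using (sum)
open import Data.Nat.Tactic.RingSolver using (solve-∀)
open import Data.Bool using (Bool; true; false; _∨_; _∧_; T)
open import Data.Bool.Properties using (¬-not)
open import Data.Unit using (⊤; tt)
open import Data.Empty using (⊥; ⊥-elim)
open import Data.Fin using (Fin; toℕ; fromℕ<) renaming (zero to fz; suc to fs)
open import Data.Fin.Properties using (toℕ-injective; toℕ-fromℕ<; fromℕ<-toℕ; toℕ<n)
open import Data.List using (List; []; _∷_; _++_; map; tabulate; length)
open import Data.List.Properties using (length-++-sucʳ)
open import Data.List.Membership.Propositional using (_∈_)
open import Data.List.Membership.Propositional.Properties using (∈-∃++)
open import Data.List.Relation.Unary.Any using (here; there)
open import Data.List.Relation.Unary.All as All using (All; []; _∷_)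
open import Data.List.Relation.Unary.AllPairs using (AllPairs; []; _∷_)
open import Data.List.Relation.Unary.Unique.Propositional using (Unique)
open import Data.Product using (Σ; ∃; _×_; _,_; proj₁; proj₂)
open import Data.Sum using (_⊎_; inj₁; inj₂)
open import Function.Definitions using (Injective)
open import Relation.Binary using (tri<; tri≈; tri>)
open import Relation.Nullary using (¬_; yes; no)
open import Relation.Binary.PropositionalEquality using (_≡_; _≢_; refl; sym; trans; cong; cong₂; subst; subst₂; module ≡-Reasoning)

∨₄-true : ∀ {a b c d} → (a ∨ b ∨ c ∨ d) ≡ true → a ≡ true ⊎ b ≡ true ⊎ c ≡ true ⊎ d ≡ true
∨₄-true {true} _ = inj₁ refl
∨₄-true {false} {true} _ = inj₂ (inj₁ refl)
∨₄-true {false} {false} {true} _ = inj₂ (inj₂ (inj₁ refl))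
∨₄-true {false} {false} {false} {true} _ = inj₂ (inj₂ (inj₂ refl))

∧-true : ∀ {a b} → (a ∧ b) ≡ true → a ≡ true × b ≡ true
∧-true {true} {true} _ = refl , refl

≡ᵇ-true : ∀ {a b} → (a ≡ᵇ b) ≡ true → a ≡ b
≡ᵇ-true {a} {b} t = ≡ᵇ⇒≡ a b (subst T (sym t) tt)

both-≡ᵇ : ∀ {a b c d} → ((a ≡ᵇ b) ∧ (c ≡ᵇ d)) ≡ true → a ≡ b × c ≡ d
both-≡ᵇ t = ≡ᵇ-true (proj₁ (∧-true t)) , ≡ᵇ-true (proj₂ (∧-true t))

consec-decode : ∀ m i j → consecB m i j ≡ true →
  (suc i ≡ j) ⊎ (suc j ≡ i) ⊎ (i ≡ 0 × suc j ≡ m) ⊎ (j ≡ 0 × suc i ≡ m)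
consec-decode m i j e with ∨₄-true {suc i ≡ᵇ j} e
... | inj₁ x = inj₁ (≡ᵇ-true x)
... | inj₂ (inj₁ x) = inj₂ (inj₁ (≡ᵇ-true x))
... | inj₂ (inj₂ (inj₁ x)) = inj₂ (inj₂ (inj₁ (both-≡ᵇ x)))
... | inj₂ (inj₂ (inj₂ x)) = inj₂ (inj₂ (inj₂ (both-≡ᵇ x)))

≡ᵇ-refl : ∀ a → (a ≡ᵇ a) ≡ true
≡ᵇ-refl zero = refl
≡ᵇ-refl (suc a) = ≡ᵇ-refl a

consec-succ : ∀ m i → consecB m i (suc i) ≡ true
consec-succ m i rewrite ≡ᵇ-refl i = refl

consec-wrap : ∀ m j → suc j ≡ m → consecB m j 0 ≡ true
consec-wrap m j refl = last-true (suc j ≡ᵇ 0) (1 ≡ᵇ j) ((j ≡ᵇ 0) ∧ (1 ≡ᵇ suc j)) (≡ᵇ-refl j)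
  where
  last-true : ∀ a b c {d} → d ≡ true → (a ∨ b ∨ c ∨ d) ≡ true
  last-true true b c refl = refl
  last-true false true c refl = refl
  last-true false false true refl = refl
  last-true false false false refl = refl

consec-sym : ∀ m i j → consecB m i j ≡ consecB m j i
consec-sym m i j = or-swap (suc i ≡ᵇ j) (suc j ≡ᵇ i) ((i ≡ᵇ 0) ∧ (suc j ≡ᵇ m)) ((j ≡ᵇ 0) ∧ (suc i ≡ᵇ m))
  where
  or-swap : ∀ a b c d → (a ∨ b ∨ c ∨ d) ≡ (b ∨ a ∨ d ∨ c)
  or-swap true true c d = refl
  or-swap true false c d = refl
  or-swap false true c d = refl
  or-swap false false true true = refl
  or-swap false false true false = refl
  or-swap false false false true = refl
  or-swap false false false false = refl

ΣN : (ℕ → ℕ) → ℕ → ℕ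
ΣN f zero = 0
ΣN f (suc m) = ΣN f m + f m

ΣN-front : ∀ (f : ℕ → ℕ) m → ΣN f (suc m) ≡ f 0 + ΣN (λ i → f (suc i)) m
ΣN-front f zero = +-comm 0 (f 0)
ΣN-front f (suc m) = trans (cong (_+ f (suc m)) (ΣN-front f m)) (+-assoc (f 0) _ _)

ΣN-cong : ∀ (f g : ℕ → ℕ) m → (∀ i → i < m → f i ≡ g i) → ΣN f m ≡ ΣN g m
ΣN-cong f g zero eq = refl
ΣN-cong f g (suc m) eq = cong₂ _+_ (ΣN-cong f g m (λ i l → eq i (m<n⇒m<1+n l))) (eq m ≤-refl)

ΣN-+ : ∀ (f g : ℕ → ℕ) m → ΣN (λ i → f i + g i) m ≡ ΣN f m + ΣN g m
ΣN-+ f g zero = refl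
ΣN-+ f g (suc m) = trans (cong (_+ (f m + g m)) (ΣN-+ f g m)) (shuffle (ΣN f m) (ΣN g m) (f m) (g m))
  where
  shuffle : ∀ a b c d → a + b + (c + d) ≡ a + c + (b + d)
  shuffle = solve-∀

ΣFin-as-ΣN : ∀ m (g : Fin m → ℕ) (g' : ℕ → ℕ) → (∀ i → g i ≡ g' (toℕ i)) → ΣFin m g ≡ ΣN g' m
ΣFin-as-ΣN m g g' eq = tab m (λ i → i) g g' eq
  where
  tab : ∀ {X : Set} m (f : Fin m → X) (g : X → ℕ) (g' : ℕ → ℕ) → (∀ i → g (f i) ≡ g' (toℕ i)) →
    sum (map g (tabulate f)) ≡ ΣN g' m
  tab zero f g g' eq = refl
  tab (suc m) f g g' eq =
    trans (cong₂ _+_ (eq fz) (tab m (λ i → f (fs i)) g (λ i → g' (suc i)) (λ i → eq (fs i))))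
          (sym (ΣN-front g' m))

count : (ℕ → Bool) → ℕ → ℕ
count g = ΣN (λ i → b2n (g i))

b2n≤1 : ∀ b → b2n b ≤ 1
b2n≤1 true = s≤s z≤n
b2n≤1 false = z≤n

count≤ : ∀ g m → count g m ≤ m
count≤ g zero = z≤n
count≤ g (suc m) = subst (_≤ suc m) (+-comm (b2n (g m)) (count g m)) (+-mono-≤ (b2n≤1 (g m)) (count≤ g m))

-- If more than c positions below m pass g, the last of them, p, still has c passing
-- positions below it.  Iterating extracts increasing witnesses p₁ < p₂ < … .
last-hit : ∀ g m c → suc c ≤ count g m → ∃ λ p → p < m × g p ≡ true × c ≤ count g p
last-hit g zero c ()
last-hit g (suc m) c le with g m in e
... | true = m , ≤-refl , e , ≤-pred (subst (suc c ≤_) (+-comm (count g m) 1) le)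
... | false with last-hit g m c (subst (suc c ≤_) (+-identityʳ (count g m)) le)
...   | p , p<m , gp , cp = p , m<n⇒m<1+n p<m , gp , cp

reflect< : ∀ {L i} → i < L → L ∸ suc i < L
reflect< = ∸-monoʳ-< (s≤s z≤n)

module _ {A : Set} where

  ∈-skip : ∀ {D x : A} ys zs → D ∈ ys ++ zs → D ∈ ys ++ x ∷ zs
  ∈-skip [] zs m = there m
  ∈-skip (y ∷ ys) zs (here e) = here e
  ∈-skip (y ∷ ys) zs (there m) = there (∈-skip ys zs m)

  module _ {R : A → A → Set} where

    All-remove : ∀ {y x : A} ys zs → All (R y) (ys ++ x ∷ zs) → All (R y) (ys ++ zs)
    All-remove [] zs (_ ∷ a) = a
    All-remove (w ∷ ys) zs (r ∷ a) = r ∷ All-remove ys zs a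

    All-at : ∀ {y x : A} ys zs → All (R y) (ys ++ x ∷ zs) → R y x
    All-at [] zs (r ∷ _) = r
    All-at (w ∷ ys) zs (_ ∷ a) = All-at ys zs a

    All-insert : ∀ {y x : A} ys zs → All (R y) (ys ++ zs) → R y x → All (R y) (ys ++ x ∷ zs)
    All-insert [] zs a r = r ∷ a
    All-insert (w ∷ ys) zs (r' ∷ a) r = r' ∷ All-insert ys zs a r

    AllPairs-remove : ∀ {x : A} ys zs → AllPairs R (ys ++ x ∷ zs) → AllPairs R (ys ++ zs)
    AllPairs-remove [] zs (_ ∷ p) = p
    AllPairs-remove (y ∷ ys) zs (a ∷ p) = All-remove ys zs a ∷ AllPairs-remove ys zs p

    AllPairs-other : ∀ {x : A} ys zs → AllPairs R (ys ++ x ∷ zs) → ∀ D → D ∈ ys ++ zs → R D x ⊎ R x D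
    AllPairs-other [] zs (a ∷ p) D m = inj₂ (All.lookup a m)
    AllPairs-other (y ∷ ys) zs (a ∷ p) D (here refl) = inj₁ (All-at ys zs a)
    AllPairs-other (y ∷ ys) zs (a ∷ p) D (there m) = AllPairs-other ys zs p D m

    AllPairs-insert : ∀ {x : A} ys zs → AllPairs R (ys ++ zs) → (∀ D → D ∈ ys ++ zs → R D x × R x D) →
      AllPairs R (ys ++ x ∷ zs)
    AllPairs-insert [] zs p f = All.tabulate (λ m → proj₂ (f _ m)) ∷ p
    AllPairs-insert (y ∷ ys) zs (a ∷ p) f =
      All-insert ys zs a (proj₁ (f y (here refl))) ∷ AllPairs-insert ys zs p (λ D m → f D (there m))

  sum-replace< : ∀ (f : A → ℕ) {x x' : A} ys zs → f x' < f x →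
    sum (map f (ys ++ x' ∷ zs)) < sum (map f (ys ++ x ∷ zs))
  sum-replace< f [] zs l = +-monoˡ-< (sum (map f zs)) l
  sum-replace< f (y ∷ ys) zs l = +-monoʳ-< (f y) (sum-replace< f ys zs l)

-- A bound on E a + E b + E c + E d proved for increasing
-- positions a < b < c < d holds for any four distinct positions: the sum is symmetric,
-- and each step below removes one possible disorder by a transposition.

≢⇒<⊎> : ∀ {a b : ℕ} → a ≢ b → a < b ⊎ b < a
≢⇒<⊎> {a} {b} a≢b with <-cmp a b
... | tri< a<b _ _ = inj₁ a<b
... | tri≈ _ a≡b _ = ⊥-elim (a≢b a≡b)
... | tri> _ _ b<a = inj₂ b<a

module FourPositions (E : ℕ → ℕ) (B M : ℕ)
  (increasing : ∀ a b c d → a < b → b < c → c < d → d < B → E a + E b + E c + E d ≤ M) where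

  Bounded : ℕ → ℕ → ℕ → ℕ → Set
  Bounded a b c d = E a + E b + E c + E d ≤ M

  private
    swap-bc : ∀ u v w z → u + w + v + z ≡ u + v + w + z
    swap-bc = solve-∀
    swap-bd : ∀ u v w z → u + z + w + v ≡ u + v + w + z
    swap-bd = solve-∀
    swap-pairs : ∀ u v w z → w + z + u + v ≡ u + v + w + z
    swap-pairs = solve-∀
    swap-ab : ∀ u v w z → v + u + w + z ≡ u + v + w + z
    swap-ab = solve-∀
    swap-cd : ∀ u v w z → u + v + z + w ≡ u + v + w + z
    swap-cd = solve-∀
    right-nested : ∀ u v w z → u + (v + (w + (z + 0))) ≡ u + v + w + z
    right-nested = solve-∀

  ends-sorted : ∀ a b c d → a < b → a < c → b < d → c < d → b ≢ c → d < B → Bounded a b c d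
  ends-sorted a b c d a<b a<c b<d c<d b≢c d<B with ≢⇒<⊎> b≢c
  ... | inj₁ b<c = increasing a b c d a<b b<c c<d d<B
  ... | inj₂ c<b = subst (_≤ M) (swap-bc (E a) (E b) (E c) (E d)) (increasing a c b d a<c c<b b<d d<B)

  least-first : ∀ a b c d → a < b → c < d → a < c → b ≢ c → b ≢ d → b < B → d < B → Bounded a b c d
  least-first a b c d a<b c<d a<c b≢c b≢d b<B d<B with ≢⇒<⊎> b≢d
  ... | inj₁ b<d = ends-sorted a b c d a<b a<c b<d c<d b≢c d<B
  ... | inj₂ d<b = subst (_≤ M) (swap-bd (E a) (E b) (E c) (E d))
      (ends-sorted a d c b (<-trans a<c c<d) a<c d<b (<-trans c<d d<b) (λ e → <-irrefl (sym e) c<d) b<B)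

  pairs-sorted : ∀ a b c d → a < b → c < d → a ≢ c → a ≢ d → b ≢ c → b ≢ d → b < B → d < B → Bounded a b c d
  pairs-sorted a b c d a<b c<d a≢c a≢d b≢c b≢d b<B d<B with ≢⇒<⊎> a≢c
  ... | inj₁ a<c = least-first a b c d a<b c<d a<c b≢c b≢d b<B d<B
  ... | inj₂ c<a = subst (_≤ M) (swap-pairs (E a) (E b) (E c) (E d))
      (least-first c d a b c<d a<b c<a (λ e → a≢d (sym e)) (λ e → b≢d (sym e)) d<B b<B)

  first-sorted : ∀ a b c d → a < b → a ≢ c → a ≢ d → b ≢ c → b ≢ d → c ≢ d → b < B → c < B → d < B →
    Bounded a b c d
  first-sorted a b c d a<b a≢c a≢d b≢c b≢d c≢d b<B c<B d<B with ≢⇒<⊎> c≢d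
  ... | inj₁ c<d = pairs-sorted a b c d a<b c<d a≢c a≢d b≢c b≢d b<B d<B
  ... | inj₂ d<c = subst (_≤ M) (swap-cd (E a) (E b) (E c) (E d))
      (pairs-sorted a b d c a<b d<c a≢d a≢c b≢d b≢c b<B c<B)

  -- the sum in the right-nested form produced by summing over a list
  any-order : ∀ a b c d → a ≢ b → a ≢ c → a ≢ d → b ≢ c → b ≢ d → c ≢ d → a < B → b < B → c < B → d < B →
    E a + (E b + (E c + (E d + 0))) ≤ M
  any-order a b c d a≢b a≢c a≢d b≢c b≢d c≢d a<B b<B c<B d<B =
    subst (_≤ M) (sym (right-nested (E a) (E b) (E c) (E d))) bound
    where
    bound : Bounded a b c d
    bound with ≢⇒<⊎> a≢b
    ... | inj₁ a<b = first-sorted a b c d a<b a≢c a≢d b≢c b≢d c≢d b<B c<B d<B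
    ... | inj₂ b<a = subst (_≤ M) (swap-ab (E a) (E b) (E c) (E d))
        (first-sorted b a c d b<a b≢c b≢d a≢c a≢d c≢d a<B c<B d<B)

module Paths {n : ℕ} (adj : Adjacency n) (adj-sym : ∀ x y → adj x y ≡ adj y x) where

  -- A path as an ℕ-indexed vertex function, injective and with consecutive vertices
  -- adjacent below its length ℓ; this keeps all index arithmetic in ℕ.
  record ℕPath : Set where
    field
      ℓ      : ℕ
      at     : ℕ → Fin n
      at-inj : ∀ i j → i < ℓ → j < ℓ → at i ≡ at j → i ≡ j
      at-adj : ∀ i → suc i < ℓ → adj (at i) (at (suc i)) ≡ true
  open ℕPath public

  OnPath : ℕPath → Fin n → Set
  OnPath P z = ∃ λ i → i < ℓ P × at P i ≡ z

  Spans : ChordedCycle adj → (Fin n → Set) → Set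
  Spans A S = ∀ z → z ∈V A → S z

  -- Fan closing: a vertex x off a path P with ≥ 2 vertices, adjacent to both ends of P and
  -- to an interior vertex P_j, spans the cycle x P₀ … P_{ℓ-1} with chord x P_j.
  fan-cycle : (P : ℕPath) (x : Fin n) → 2 ≤ ℓ P → (∀ i → i < ℓ P → at P i ≢ x) →
    adj x (at P 0) ≡ true → adj x (at P (ℓ P ∸ 1)) ≡ true →
    (j : ℕ) → 0 < j → suc j < ℓ P → adj x (at P j) ≡ true →
    Σ (ChordedCycle adj) λ A → Spans A (λ z → z ≡ x ⊎ OnPath P z)
  fan-cycle P x two off x-first x-last j 0<j j+1<ℓ x-j =
    record { cyc = cycle ; chord = fz , fs (fromℕ< j<ℓ) , (λ ()) , non-consec , chord-edge } , spans
    where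
    L : ℕ
    L = suc (ℓ P)

    v : Fin L → Fin n
    v fz = x
    v (fs i) = at P (toℕ i)

    v-inj : Injective _≡_ _≡_ v
    v-inj {fz} {fz} e = refl
    v-inj {fz} {fs b} e = ⊥-elim (off (toℕ b) (toℕ<n b) (sym e))
    v-inj {fs a} {fz} e = ⊥-elim (off (toℕ a) (toℕ<n a) e)
    v-inj {fs a} {fs b} e = cong fs (toℕ-injective (at-inj P _ _ (toℕ<n a) (toℕ<n b) e))

    ℓ≢0 : ¬ (1 ≡ L)
    ℓ≢0 q = <-irrefl (suc-injective q) (<-trans (s≤s z≤n) two)

    x-edge : ∀ (b : Fin (ℓ P)) → consecB L 0 (suc (toℕ b)) ≡ true → adj x (at P (toℕ b)) ≡ true
    x-edge b e with consec-decode L 0 (suc (toℕ b)) e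
    ... | inj₁ q = subst (λ t → adj x (at P t) ≡ true) (suc-injective q) x-first
    ... | inj₂ (inj₁ ())
    ... | inj₂ (inj₂ (inj₁ (_ , q))) = subst (λ t → adj x (at P t) ≡ true) (sym (cong (_∸ 1) (suc-injective q))) x-last
    ... | inj₂ (inj₂ (inj₂ (() , _)))

    edge : ∀ a b → consecB L (toℕ a) (toℕ b) ≡ true → adj (v a) (v b) ≡ true
    edge fz fz e with consec-decode L 0 0 e
    ... | inj₁ ()
    ... | inj₂ (inj₁ ())
    ... | inj₂ (inj₂ (inj₁ (_ , q))) = ⊥-elim (ℓ≢0 q)
    ... | inj₂ (inj₂ (inj₂ (_ , q))) = ⊥-elim (ℓ≢0 q)
    edge fz (fs b) e = x-edge b e
    edge (fs a) fz e = trans (adj-sym _ _) (x-edge a (trans (consec-sym L 0 (suc (toℕ a))) e))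
    edge (fs a) (fs b) e with consec-decode L (suc (toℕ a)) (suc (toℕ b)) e
    ... | inj₁ q = subst (λ t → adj (at P (toℕ a)) (at P t) ≡ true) (suc-injective q)
                     (at-adj P (toℕ a) (subst (_< ℓ P) (sym (suc-injective q)) (toℕ<n b)))
    ... | inj₂ (inj₁ q) = trans (adj-sym _ _) (subst (λ t → adj (at P (toℕ b)) (at P t) ≡ true) (suc-injective q)
                     (at-adj P (toℕ b) (subst (_< ℓ P) (sym (suc-injective q)) (toℕ<n a))))
    ... | inj₂ (inj₂ (inj₁ (() , _)))
    ... | inj₂ (inj₂ (inj₂ (() , _)))

    cycle : Cycle adj
    cycle = record { len = L ; vert = v ; len≥3 = s≤s two ; inj = v-inj ; edges = edge }

    j<ℓ : j < ℓ P
    j<ℓ = <-trans (n<1+n j) j+1<ℓ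

    non-consec : consecB L 0 (toℕ (fs (fromℕ< j<ℓ))) ≡ false
    non-consec rewrite toℕ-fromℕ< j<ℓ = ¬-not (λ e → absurd (consec-decode L 0 (suc j) e))
      where
      absurd : _ → ⊥
      absurd (inj₁ q) = <-irrefl (suc-injective q) 0<j
      absurd (inj₂ (inj₁ ()))
      absurd (inj₂ (inj₂ (inj₁ (_ , q)))) = <-irrefl (suc-injective q) j+1<ℓ
      absurd (inj₂ (inj₂ (inj₂ (() , _))))

    chord-edge : adj x (at P (toℕ (fromℕ< j<ℓ))) ≡ true
    chord-edge rewrite toℕ-fromℕ< j<ℓ = x-j

    spans : Spans record { cyc = cycle ; chord = fz , fs (fromℕ< j<ℓ) , (λ ()) , non-consec , chord-edge }
                  (λ z → z ≡ x ⊎ OnPath P z)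
    spans z (fz , e) = inj₁ (sym e)
    spans z (fs i , e) = inj₂ (toℕ i , toℕ<n i , e)

  single : Fin n → ℕPath
  single c = record { ℓ = 1 ; at = λ _ → c ; at-inj = inj1 ; at-adj = λ { i (s≤s ()) } }
    where
    inj1 : ∀ i j → i < 1 → j < 1 → c ≡ c → i ≡ j
    inj1 zero zero _ _ _ = refl
    inj1 (suc i) _ (s≤s ()) _ _
    inj1 zero (suc j) _ (s≤s ()) _

  cons : (o : Fin n) (P : ℕPath) → (∀ i → i < ℓ P → at P i ≢ o) → adj o (at P 0) ≡ true → ℕPath
  cons o P off o-first = record { ℓ = suc (ℓ P) ; at = at' ; at-inj = inj' ; at-adj = adj' }
    where
    at' : ℕ → Fin n
    at' zero = o
    at' (suc i) = at P i
    inj' : ∀ i j → i < suc (ℓ P) → j < suc (ℓ P) → at' i ≡ at' j → i ≡ j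
    inj' zero zero _ _ _ = refl
    inj' zero (suc j) _ jl e = ⊥-elim (off j (≤-pred jl) (sym e))
    inj' (suc i) zero il _ e = ⊥-elim (off i (≤-pred il) e)
    inj' (suc i) (suc j) il jl e = cong suc (at-inj P i j (≤-pred il) (≤-pred jl) e)
    adj' : ∀ i → suc i < suc (ℓ P) → adj (at' i) (at' (suc i)) ≡ true
    adj' zero _ = o-first
    adj' (suc i) l = at-adj P i (≤-pred l)

  OnPath-cons : ∀ o P off o-first z → OnPath (cons o P off o-first) z → z ≡ o ⊎ OnPath P z
  OnPath-cons o P off o-first z (zero , _ , e) = inj₁ (sym e)
  OnPath-cons o P off o-first z (suc i , l , e) = inj₂ (i , ≤-pred l , e)

  edge-path : (c d : Fin n) → d ≢ c → adj c d ≡ true → ℕPath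
  edge-path c d d≢c cd = cons c (single d) (λ { zero _ → d≢c ; (suc i) (s≤s ()) }) cd

  OnPath-edge : ∀ c d d≢c cd z → OnPath (edge-path c d d≢c cd) z → z ≡ c ⊎ z ≡ d
  OnPath-edge c d d≢c cd z (zero , _ , e) = inj₁ (sym e)
  OnPath-edge c d d≢c cd z (suc zero , _ , e) = inj₂ (sym e)
  OnPath-edge c d d≢c cd z (suc (suc i) , s≤s (s≤s ()) , e)

  reverse : ℕPath → ℕPath
  reverse P = record { ℓ = ℓ P ; at = λ i → at P (ℓ P ∸ suc i) ; at-inj = inj' ; at-adj = adj' }
    where
    inj' : ∀ i j → i < ℓ P → j < ℓ P → at P (ℓ P ∸ suc i) ≡ at P (ℓ P ∸ suc j) → i ≡ j
    inj' i j il jl e = suc-injective (∸-cancelˡ-≡ il jl (at-inj P _ _ (reflect< il) (reflect< jl) e))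
    adj' : ∀ i → suc i < ℓ P → adj (at P (ℓ P ∸ suc i)) (at P (ℓ P ∸ suc (suc i))) ≡ true
    adj' i l = trans (adj-sym _ _) (subst (λ t → adj (at P (ℓ P ∸ suc (suc i))) (at P t) ≡ true)
      (sym (+-∸-assoc 1 l))
      (at-adj P (ℓ P ∸ suc (suc i)) (subst (_< ℓ P) (+-∸-assoc 1 l) (reflect< (<⇒≤ l)))))

  OnPath-reverse : ∀ P z → OnPath (reverse P) z → OnPath P z
  OnPath-reverse P z (i , l , e) = ℓ P ∸ suc i , reflect< l , e

  reverse-last : ∀ P → 1 ≤ ℓ P → at (reverse P) (ℓ P ∸ 1) ≡ at P 0
  reverse-last P l = cong (at P) (last-index (ℓ P) l)
    where
    last-index : ∀ L → 1 ≤ L → L ∸ suc (L ∸ 1) ≡ 0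
    last-index (suc L) _ = n∸n≡0 L

  segment : (P : ℕPath) (a b : ℕ) → a ≤ b → b < ℓ P → ℕPath
  segment P a b a≤b b<ℓ = record { ℓ = suc (b ∸ a) ; at = λ i → at P (a + i) ; at-inj = inj' ; at-adj = adj' }
    where
    inside : ∀ i → i < suc (b ∸ a) → a + i < ℓ P
    inside i l = ≤-<-trans (subst (a + i ≤_) (m+[n∸m]≡n a≤b) (+-monoʳ-≤ a (≤-pred l))) b<ℓ
    inj' : ∀ i j → i < suc (b ∸ a) → j < suc (b ∸ a) → at P (a + i) ≡ at P (a + j) → i ≡ j
    inj' i j il jl e = +-cancelˡ-≡ a i j (at-inj P _ _ (inside i il) (inside j jl) e)
    adj' : ∀ i → suc i < suc (b ∸ a) → adj (at P (a + i)) (at P (a + suc i)) ≡ true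
    adj' i l = subst (λ t → adj (at P (a + i)) (at P t) ≡ true) (sym (+-suc a i))
      (at-adj P (a + i) (subst (_< ℓ P) (+-suc a i) (inside (suc i) l)))

  OnPath-segment : ∀ P a b a≤b b<ℓ z → OnPath (segment P a b a≤b b<ℓ) z → ∃ λ p → a ≤ p × p ≤ b × at P p ≡ z
  OnPath-segment P a b a≤b b<ℓ z (i , l , e) =
    a + i , m≤m+n a i , subst (a + i ≤_) (m+[n∸m]≡n a≤b) (+-monoʳ-≤ a (≤-pred l)) , e

  -- Fan with a pendant: x adjacent to o and to both ends of P, with o adjacent to P₀,
  -- spans the cycle x o P₀ … P_{ℓ-1} with chord x P₀.
  pendant-first-cycle : (P : ℕPath) (x o : Fin n) → 2 ≤ ℓ P → (∀ i → i < ℓ P → at P i ≢ x) →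
    (∀ i → i < ℓ P → at P i ≢ o) → o ≢ x → adj x o ≡ true → adj x (at P 0) ≡ true →
    adj x (at P (ℓ P ∸ 1)) ≡ true → adj o (at P 0) ≡ true →
    Σ (ChordedCycle adj) λ A → Spans A (λ z → z ≡ x ⊎ z ≡ o ⊎ OnPath P z)
  pendant-first-cycle P x o two x-off o-off o≢x x-o x-first x-last o-first
    with fan-cycle oP x (s≤s (<-trans (s≤s z≤n) two)) oP-off x-o x-last' 1 (s≤s z≤n) (s≤s two) x-first
    where
    oP : ℕPath
    oP = cons o P o-off o-first
    oP-off : ∀ i → i < ℓ oP → at oP i ≢ x
    oP-off zero _ = o≢x
    oP-off (suc i) l = x-off i (≤-pred l)
    x-last' : adj x (at oP (ℓ oP ∸ 1)) ≡ true
    x-last' = subst (λ t → adj x (at oP t) ≡ true) (m+[n∸m]≡n {1} (<-trans (s≤s z≤n) two)) x-last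
  ... | A , spans = A , λ z z∈ → lift (spans z z∈)
    where
    lift : ∀ {z} → z ≡ x ⊎ OnPath (cons o P o-off o-first) z → z ≡ x ⊎ z ≡ o ⊎ OnPath P z
    lift (inj₁ e) = inj₁ e
    lift {z} (inj₂ on) = inj₂ (OnPath-cons o P o-off o-first z on)

  pendant-last-cycle : (P : ℕPath) (x o : Fin n) → 2 ≤ ℓ P → (∀ i → i < ℓ P → at P i ≢ x) →
    (∀ i → i < ℓ P → at P i ≢ o) → o ≢ x → adj x o ≡ true → adj x (at P 0) ≡ true →
    adj x (at P (ℓ P ∸ 1)) ≡ true → adj o (at P (ℓ P ∸ 1)) ≡ true →
    Σ (ChordedCycle adj) λ A → Spans A (λ z → z ≡ x ⊎ z ≡ o ⊎ OnPath P z)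
  pendant-last-cycle P x o two x-off o-off o≢x x-o x-first x-last o-last
    with pendant-first-cycle (reverse P) x o two (λ i l → x-off _ (reflect< l)) (λ i l → o-off _ (reflect< l))
           o≢x x-o x-last (subst (λ t → adj x t ≡ true) (sym (reverse-last P (<-trans (s≤s z≤n) two))) x-first) o-last
  ... | A , spans = A , λ z z∈ → lift (spans z z∈)
    where
    lift : ∀ {z} → z ≡ x ⊎ z ≡ o ⊎ OnPath (reverse P) z → z ≡ x ⊎ z ≡ o ⊎ OnPath P z
    lift (inj₁ e) = inj₁ e
    lift (inj₂ (inj₁ e)) = inj₂ (inj₁ e)
    lift {z} (inj₂ (inj₂ on)) = inj₂ (inj₂ (OnPath-reverse P z on))

  diamond : (a b c d : Fin n) → b ≢ a → c ≢ a → d ≢ a → c ≢ b → d ≢ b → d ≢ c →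
    adj a b ≡ true → adj b c ≡ true → adj c d ≡ true → adj a d ≡ true → adj a c ≡ true →
    Σ (ChordedCycle adj) λ A → Spans A (λ z → z ≡ a ⊎ z ≡ b ⊎ z ≡ c ⊎ z ≡ d)
  diamond a b c d b≢a c≢a d≢a c≢b d≢b d≢c ab bc cd ad ac
    with pendant-first-cycle (edge-path c d d≢c cd) a b (s≤s (s≤s z≤n))
           (λ { zero _ → c≢a ; (suc zero) _ → d≢a ; (suc (suc i)) (s≤s (s≤s ())) })
           (λ { zero _ → c≢b ; (suc zero) _ → d≢b ; (suc (suc i)) (s≤s (s≤s ())) })
           b≢a ab ac ad bc
  ... | A , spans = A , λ z z∈ → lift (spans z z∈)
    where
    lift : ∀ {z} → z ≡ a ⊎ z ≡ b ⊎ OnPath (edge-path c d d≢c cd) z → z ≡ a ⊎ z ≡ b ⊎ z ≡ c ⊎ z ≡ d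
    lift (inj₁ e) = inj₁ e
    lift (inj₂ (inj₁ e)) = inj₂ (inj₁ e)
    lift {z} (inj₂ (inj₂ on)) = inj₂ (inj₂ (OnPath-edge c d d≢c cd z on))

-- A nonempty Fin-indexed family read as an ℕ-indexed one (entry 0 is repeated beyond
-- the range), so that positions on Q and C are plain natural numbers.

extend : ∀ {A : Set} m → 0 < m → (Fin m → A) → ℕ → A
extend m m>0 f p with p <? m
... | yes p<m = f (fromℕ< p<m)
... | no _ = f (fromℕ< m>0)

extend-eq : ∀ {A : Set} m m>0 (f : Fin m → A) p (p<m : p < m) → extend m m>0 f p ≡ f (fromℕ< p<m)
extend-eq m m>0 f p p<m with p <? m
... | yes _ = refl
... | no p≮m = ⊥-elim (p≮m p<m)

extend-toℕ : ∀ {A : Set} m m>0 (f : Fin m → A) (i : Fin m) → f i ≡ extend m m>0 f (toℕ i)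
extend-toℕ m m>0 f i = trans (cong f (sym (fromℕ<-toℕ i (toℕ<n i)))) (sym (extend-eq m m>0 f _ (toℕ<n i)))

extend-inj : ∀ {A : Set} m m>0 (f : Fin m → A) → Injective _≡_ _≡_ f →
  ∀ p q → p < m → q < m → extend m m>0 f p ≡ extend m m>0 f q → p ≡ q
extend-inj m m>0 f f-inj p q p<m q<m e = trans (sym (toℕ-fromℕ< p<m))
  (trans (cong toℕ (f-inj (trans (sym (extend-eq m m>0 f p p<m)) (trans e (extend-eq m m>0 f q q<m)))))
         (toℕ-fromℕ< q<m))

three-of-four : ∀ w x y z → 3 ≤ (b2n w + b2n x) + (b2n y + b2n z) →
  (w ≡ true × y ≡ true × (x ≡ true ⊎ z ≡ true)) ⊎ (x ≡ true × z ≡ true × (w ≡ true ⊎ y ≡ true))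
three-of-four true  true  true  z     _ = inj₁ (refl , refl , inj₁ refl)
three-of-four true  false true  true  _ = inj₁ (refl , refl , inj₂ refl)
three-of-four true  true  false true  _ = inj₂ (refl , refl , inj₁ refl)
three-of-four false true  true  true  _ = inj₂ (refl , refl , inj₂ refl)
three-of-four true  false true  false (s≤s (s≤s ()))
three-of-four true  true  false false (s≤s (s≤s ()))
three-of-four true  false false true  (s≤s (s≤s ()))
three-of-four false true  true  false (s≤s (s≤s ()))
three-of-four false true  false true  (s≤s (s≤s ()))
three-of-four false false true  true  (s≤s (s≤s ()))
three-of-four true  false false false (s≤s ())
three-of-four false true  false false (s≤s ())
three-of-four false false true  false (s≤s ())
three-of-four false false false true  (s≤s ())
three-of-four false false false false ()

two-of-three : ∀ a b c → 2 ≤ b2n a + b2n b + b2n c →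
  (a ≡ true × b ≡ true) ⊎ (a ≡ true × c ≡ true) ⊎ (b ≡ true × c ≡ true)
two-of-three true  true  c     _ = inj₁ (refl , refl)
two-of-three true  false true  _ = inj₂ (inj₁ (refl , refl))
two-of-three false true  true  _ = inj₂ (inj₂ (refl , refl))
two-of-three true  false false (s≤s ())
two-of-three false true  false (s≤s ())
two-of-three false false true  (s≤s ())
two-of-three false false false ()

drop-one : ∀ a s → a ≤ 1 → 3 ≤ a + s → 2 ≤ s
drop-one a s a≤1 3≤a+s = ≤-pred (≤-trans 3≤a+s (+-monoˡ-≤ s a≤1))

at-most-two : ∀ x → ¬ 3 ≤ x → x ≤ 2
at-most-two x x≱3 = ≤-pred (≰⇒> x≱3)

-- The setting of Lemma 14.

module Frame (k n : ℕ) (k≥2 : k ≥ 2) (adj : Adjacency n) (adj-sym : ∀ x y → adj x y ≡ adj y x)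
  (no-k-cycles : ¬ HasDisjointChordedCycles adj k)
  (𝒞 : Collection adj (k ∸ 1)) (o1 : O1 𝒞)
  (Q : Path adj) (Q-in-R : PathIn 𝒞 Q) (Q≢∅ : 0 < plen Q)
  (C : ChordedCycle adj) (C∈𝒞 : C ∈ cycles 𝒞) where

  open Paths adj adj-sym public

  ℓC ℓQ : ℕ
  ℓC = len (cyc C)
  ℓQ = plen Q

  C≢∅ : 0 < ℓC
  C≢∅ = ≤-trans (s≤s z≤n) (len≥3 (cyc C))

  Q[_] C[_] : ℕ → Fin n
  Q[_] = extend ℓQ Q≢∅ (pvert Q)
  C[_] = extend ℓC C≢∅ (vert (cyc C))

  Q-adj : ∀ p → suc p < ℓQ → adj Q[ p ] Q[ suc p ] ≡ true
  Q-adj p p+1<ℓ = subst₂ (λ u v → adj u v ≡ true) (sym (extend-eq ℓQ Q≢∅ (pvert Q) p p<ℓ))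
      (sym (extend-eq ℓQ Q≢∅ (pvert Q) (suc p) p+1<ℓ))
      (pedges Q (fromℕ< p<ℓ) (fromℕ< p+1<ℓ) (trans (cong suc (toℕ-fromℕ< p<ℓ)) (sym (toℕ-fromℕ< p+1<ℓ))))
    where
    p<ℓ : p < ℓQ
    p<ℓ = <-trans (n<1+n p) p+1<ℓ

  C-adj : ∀ a b → a < ℓC → b < ℓC → consecB ℓC a b ≡ true → adj C[ a ] C[ b ] ≡ true
  C-adj a b a<ℓ b<ℓ e = subst₂ (λ u v → adj u v ≡ true)
    (sym (extend-eq ℓC C≢∅ (vert (cyc C)) a a<ℓ)) (sym (extend-eq ℓC C≢∅ (vert (cyc C)) b b<ℓ))
    (edges (cyc C) (fromℕ< a<ℓ) (fromℕ< b<ℓ)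
      (subst₂ (λ u v → consecB ℓC u v ≡ true) (sym (toℕ-fromℕ< a<ℓ)) (sym (toℕ-fromℕ< b<ℓ)) e))

  Q-inj : ∀ p q → p < ℓQ → q < ℓQ → Q[ p ] ≡ Q[ q ] → p ≡ q
  Q-inj = extend-inj ℓQ Q≢∅ (pvert Q) (pinj Q)

  C-inj : ∀ a b → a < ℓC → b < ℓC → C[ a ] ≡ C[ b ] → a ≡ b
  C-inj = extend-inj ℓC C≢∅ (vert (cyc C)) (inj (cyc C))

  C-distinct : ∀ a b → a < ℓC → b < ℓC → a ≢ b → C[ a ] ≢ C[ b ]
  C-distinct a b a<ℓ b<ℓ a≢b e = a≢b (C-inj a b a<ℓ b<ℓ e)

  -- Q and C as ℕPaths (C without its closing edge)
  Q-path C-path : ℕPath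
  Q-path = record { ℓ = ℓQ ; at = Q[_] ; at-inj = Q-inj ; at-adj = Q-adj }
  C-path = record { ℓ = ℓC ; at = C[_] ; at-inj = C-inj
                  ; at-adj = λ i l → C-adj i (suc i) (<-trans (n<1+n i) l) l (consec-succ ℓC i) }

  C-on-C : ∀ r → r < ℓC → C[ r ] ∈V C
  C-on-C r r<ℓ = fromℕ< r<ℓ , sym (extend-eq ℓC C≢∅ (vert (cyc C)) r r<ℓ)

  Q-uncovered : ∀ p → p < ℓQ → ¬ Covered 𝒞 Q[ p ]
  Q-uncovered p p<ℓ = subst (λ z → ¬ Covered 𝒞 z) (sym (extend-eq ℓQ Q≢∅ (pvert Q) p p<ℓ)) (Q-in-R (fromℕ< p<ℓ))

  C≢Q : ∀ r p → r < ℓC → p < ℓQ → C[ r ] ≢ Q[ p ]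
  C≢Q r p r<ℓ p<ℓ e = Q-uncovered p p<ℓ (C , C∈𝒞 , subst (_∈V C) e (C-on-C r r<ℓ))

  Among : (ℕ → Set) → (ℕ → Set) → Fin n → Set
  Among SC SQ z = (∃ λ r → SC r × r < ℓC × C[ r ] ≡ z) ⊎ (∃ λ p → SQ p × p < ℓQ × Q[ p ] ≡ z)

  Supported : ChordedCycle adj → (ℕ → Set) → (ℕ → Set) → Set
  Supported A SC SQ = Spans A (Among SC SQ)

  Supported-mono : ∀ A {SC SQ SC' SQ'} → (∀ t → SC t → SC' t) → (∀ t → SQ t → SQ' t) →
    Supported A SC SQ → Supported A SC' SQ'
  Supported-mono A fC fQ sA z z∈ with sA z z∈
  ... | inj₁ (r , s , l , e) = inj₁ (r , fC r s , l , e)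
  ... | inj₂ (p , s , l , e) = inj₂ (p , fQ p s , l , e)

  Supported-disjoint : ∀ (A B : ChordedCycle adj) {SC SQ SC' SQ'} → Supported A SC SQ → Supported B SC' SQ' →
    (∀ r → SC r → SC' r → ⊥) → (∀ p → SQ p → SQ' p → ⊥) → VDisjoint A B
  Supported-disjoint A B {SC' = SC'} {SQ' = SQ'} sA sB dC dQ z zA zB with sA z zA | sB z zB
  ... | inj₁ (r , s , r<ℓ , e) | inj₁ (r' , s' , r'<ℓ , e') = dC r s (subst SC' (C-inj r' r r'<ℓ r<ℓ (trans e' (sym e))) s')
  ... | inj₁ (r , _ , r<ℓ , e) | inj₂ (p , _ , p<ℓ , e') = C≢Q r p r<ℓ p<ℓ (trans e (sym e'))
  ... | inj₂ (p , _ , p<ℓ , e) | inj₁ (r , _ , r<ℓ , e') = C≢Q r p r<ℓ p<ℓ (trans e' (sym e))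
  ... | inj₂ (p , s , p<ℓ , e) | inj₂ (p' , s' , p'<ℓ , e') = dQ p s (subst SQ' (Q-inj p' p p'<ℓ p<ℓ (trans e' (sym e))) s')

  module Around (ys zs : List (ChordedCycle adj)) (𝒞≡ : cycles 𝒞 ≡ ys ++ C ∷ zs) where
    pairwise : AllPairs VDisjoint (ys ++ C ∷ zs)
    pairwise = subst (AllPairs VDisjoint) 𝒞≡ (disjoint 𝒞)

    others-size : suc (length (ys ++ zs)) ≡ k ∸ 1
    others-size = trans (sym (length-++-sucʳ ys C zs)) (trans (cong length (sym 𝒞≡)) (size 𝒞))

    avoids-others : ∀ (X : ChordedCycle adj) {SC SQ} → Supported X SC SQ → ∀ D → D ∈ ys ++ zs → VDisjoint X D
    avoids-others X sX D D∈ z zX zD with sX z zX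
    ... | inj₁ (r , _ , r<ℓ , e) with AllPairs-other ys zs pairwise D D∈
    ...   | inj₁ D-C = D-C z zD (subst (_∈V C) e (C-on-C r r<ℓ))
    ...   | inj₂ C-D = C-D z (subst (_∈V C) e (C-on-C r r<ℓ)) zD
    avoids-others X sX D D∈ z zX zD | inj₂ (p , _ , p<ℓ , e) =
      Q-uncovered p p<ℓ (D , subst (D ∈_) (sym 𝒞≡) (∈-skip ys zs D∈) , subst (_∈V D) (sym e) zD)

  -- (swap) two disjoint chorded cycles inside C ∪ Q, together with 𝒞 - C, would be k
  -- disjoint chorded cycles
  no-two-disjoint : ∀ (A B : ChordedCycle adj) {SC SQ SC' SQ'} → Supported A SC SQ → Supported B SC' SQ' →
    (∀ r → SC r → SC' r → ⊥) → (∀ p → SQ p → SQ' p → ⊥) → ⊥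
  no-two-disjoint A B sA sB dC dQ with ∈-∃++ C∈𝒞
  ... | ys , zs , 𝒞≡ = no-k-cycles record { cycles = A ∷ B ∷ (ys ++ zs) ; size = size' ; disjoint = disjoint' }
    where
    open Around ys zs 𝒞≡
    size' : suc (suc (length (ys ++ zs))) ≡ k
    size' = trans (cong suc others-size) (m+[n∸m]≡n {1} {k} (≤-trans (s≤s z≤n) k≥2))
    disjoint' : AllPairs VDisjoint (A ∷ B ∷ (ys ++ zs))
    disjoint' = All.tabulate (λ { (here refl) → Supported-disjoint A B sA sB dC dQ ; (there m) → avoids-others A sA _ m })
              ∷ All.tabulate (λ m → avoids-others B sB _ m) ∷ AllPairs-remove ys zs pairwise

  -- (O1) a chorded cycle inside C ∪ Q is not shorter than C: otherwise replacing C by it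
  -- would decrease the total number of vertices of 𝒞
  no-shorter : ∀ (A : ChordedCycle adj) {SC SQ} → Supported A SC SQ → len (cyc A) < ℓC → ⊥
  no-shorter A sA shorter with ∈-∃++ C∈𝒞
  ... | ys , zs , 𝒞≡ = <⇒≱ (sum-replace< (λ D → len (cyc D)) ys zs shorter)
      (subst (_≤ totalVerts 𝒟) (cong (λ l → sum (map (λ D → len (cyc D)) l)) 𝒞≡) (o1 𝒟))
    where
    open Around ys zs 𝒞≡
    𝒟 : Collection adj (k ∸ 1)
    𝒟 = record { cycles = ys ++ A ∷ zs ; size = trans (length-++-sucʳ ys A zs) others-size
               ; disjoint = AllPairs-insert ys zs (AllPairs-remove ys zs pairwise)
                   (λ D m → (λ z zD zA → avoids-others A sA D m z zA zD) , avoids-others A sA D m) }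

  flip : ∀ {x y} → adj x y ≡ true → adj y x ≡ true
  flip {x} {y} e = trans (adj-sym y x) e

  flip-either : ∀ {x y z} → adj x z ≡ true ⊎ adj y z ≡ true → adj z x ≡ true ⊎ adj z y ≡ true
  flip-either (inj₁ e) = inj₁ (flip e)
  flip-either (inj₂ e) = inj₂ (flip e)

  module QSegment (p q : ℕ) (p<q : p < q) (q<ℓ : q < ℓQ) where
    P : ℕPath
    P = segment Q-path p q (<⇒≤ p<q) q<ℓ
    two : 2 ≤ ℓ P
    two = s≤s (m<n⇒0<n∸m p<q)
    first : at P 0 ≡ Q[ p ]
    first = cong Q[_] (+-identityʳ p)
    last : at P (ℓ P ∸ 1) ≡ Q[ q ]
    last = cong Q[_] (m+[n∸m]≡n (<⇒≤ p<q))
    off-C : ∀ r → r < ℓC → ∀ i → i < ℓ P → at P i ≢ C[ r ]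
    off-C r r<ℓ i l e = C≢Q r (p + i) r<ℓ
      (≤-<-trans (subst (p + i ≤_) (m+[n∸m]≡n (<⇒≤ p<q)) (+-monoʳ-≤ p (≤-pred l))) q<ℓ) (sym e)
    on-segment : ∀ z → OnPath P z → ∃ λ t → (p ≤ t × t ≤ q) × t < ℓQ × Q[ t ] ≡ z
    on-segment z on with OnPath-segment Q-path p q (<⇒≤ p<q) q<ℓ z on
    ... | t , p≤t , t≤q , e = t , (p≤t , t≤q) , ≤-<-trans t≤q q<ℓ , e

  edge-segment-cycle : ∀ p q a b → p < q → q < ℓQ → a < ℓC → b < ℓC → b ≢ a →
    adj C[ a ] C[ b ] ≡ true → adj C[ a ] Q[ p ] ≡ true → adj C[ a ] Q[ q ] ≡ true →
    adj C[ b ] Q[ p ] ≡ true ⊎ adj C[ b ] Q[ q ] ≡ true →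
    Σ (ChordedCycle adj) λ A → Supported A (λ t → t ≡ a ⊎ t ≡ b) (λ t → p ≤ t × t ≤ q)
  edge-segment-cycle p q a b p<q q<ℓ a<ℓ b<ℓ b≢a ab ap aq b-end = close b-end
    where
    open QSegment p q p<q q<ℓ
    Cb≢Ca : C[ b ] ≢ C[ a ]
    Cb≢Ca e = b≢a (C-inj b a b<ℓ a<ℓ e)
    a-first : adj C[ a ] (at P 0) ≡ true
    a-first = subst (λ t → adj C[ a ] t ≡ true) (sym first) ap
    a-last : adj C[ a ] (at P (ℓ P ∸ 1)) ≡ true
    a-last = subst (λ t → adj C[ a ] t ≡ true) (sym last) aq
    supported : ∀ {A} → Spans A (λ z → z ≡ C[ a ] ⊎ z ≡ C[ b ] ⊎ OnPath P z) →
      Supported A (λ t → t ≡ a ⊎ t ≡ b) (λ t → p ≤ t × t ≤ q)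
    supported sA z z∈ with sA z z∈
    ... | inj₁ e = inj₁ (a , inj₁ refl , a<ℓ , sym e)
    ... | inj₂ (inj₁ e) = inj₁ (b , inj₂ refl , b<ℓ , sym e)
    ... | inj₂ (inj₂ on) = inj₂ (on-segment z on)
    close : adj C[ b ] Q[ p ] ≡ true ⊎ adj C[ b ] Q[ q ] ≡ true →
      Σ (ChordedCycle adj) λ A → Supported A (λ t → t ≡ a ⊎ t ≡ b) (λ t → p ≤ t × t ≤ q)
    close (inj₁ bp) with pendant-first-cycle P C[ a ] C[ b ] two (off-C a a<ℓ) (off-C b b<ℓ) Cb≢Ca ab a-first a-last
                           (subst (λ t → adj C[ b ] t ≡ true) (sym first) bp)
    ... | A , sA = A , supported {A} sA
    close (inj₂ bq) with pendant-last-cycle P C[ a ] C[ b ] two (off-C a a<ℓ) (off-C b b<ℓ) Cb≢Ca ab a-first a-last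
                           (subst (λ t → adj C[ b ] t ≡ true) (sym last) bq)
    ... | A , sA = A , supported {A} sA

  hit : ℕ → ℕ → ℕ
  hit p r = b2n (adj Q[ p ] C[ r ])

  heavy-edge-cycle : ∀ p q r r' → p < q → q < ℓQ → r < ℓC → r' < ℓC → r' ≢ r → adj C[ r ] C[ r' ] ≡ true →
    3 ≤ (hit p r + hit p r') + (hit q r + hit q r') →
    Σ (ChordedCycle adj) λ A → Supported A (λ t → t ≡ r ⊎ t ≡ r') (λ t → p ≤ t × t ≤ q)
  heavy-edge-cycle p q r r' p<q q<ℓ r<ℓ r'<ℓ r'≢r rr' three
    with three-of-four (adj Q[ p ] C[ r ]) (adj Q[ p ] C[ r' ]) (adj Q[ q ] C[ r ]) (adj Q[ q ] C[ r' ]) three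
  ... | inj₁ (pr , qr , r'-end) =
        edge-segment-cycle p q r r' p<q q<ℓ r<ℓ r'<ℓ r'≢r rr' (flip pr) (flip qr) (flip-either r'-end)
  ... | inj₂ (pr' , qr' , r-end) with edge-segment-cycle p q r' r p<q q<ℓ r'<ℓ r<ℓ (λ e → r'≢r (sym e))
                                        (flip rr') (flip pr') (flip qr') (flip-either r-end)
  ...   | A , sA = A , Supported-mono A (λ { t (inj₁ e) → inj₂ e ; t (inj₂ e) → inj₁ e }) (λ t s → s) sA

  three-neighbours-cycle : ∀ r u m w → u < m → m < w → w < ℓQ → r < ℓC →
    adj C[ r ] Q[ u ] ≡ true → adj C[ r ] Q[ m ] ≡ true → adj C[ r ] Q[ w ] ≡ true →
    Σ (ChordedCycle adj) λ A → Supported A (_≡ r) (λ t → u ≤ t × t ≤ w)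
  three-neighbours-cycle r u m w u<m m<w w<ℓ r<ℓ ru rm rw
    with fan-cycle P C[ r ] two (off-C r r<ℓ) (subst (λ t → adj C[ r ] t ≡ true) (sym first) ru)
           (subst (λ t → adj C[ r ] t ≡ true) (sym last) rw) (m ∸ u) (m<n⇒0<n∸m u<m)
           (s≤s (∸-monoˡ-< m<w (<⇒≤ u<m))) (subst (λ t → adj C[ r ] t ≡ true) (cong Q[_] (sym (m+[n∸m]≡n (<⇒≤ u<m)))) rm)
    where
    open QSegment u w (<-trans u<m m<w) w<ℓ
  ... | A , sA = A , supported
    where
    open QSegment u w (<-trans u<m m<w) w<ℓ
    supported : Supported A (_≡ r) (λ t → u ≤ t × t ≤ w)
    supported z z∈ with sA z z∈
    ... | inj₁ e = inj₁ (r , refl , r<ℓ , sym e)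
    ... | inj₂ on = inj₂ (on-segment z on)

  deg-C : ℕ → ℕ
  deg-C p = count (λ r → adj Q[ p ] C[ r ]) ℓC

  -- (O1) If |C| ≥ 5, the vertex x = Q[p] has no four neighbours C[p₁], …, C[p₄] with
  -- p₁ < p₂ < p₃ < p₄: x with the arc C[p₁] … C[p₃] and chord xC[p₂] is a shorter chorded
  -- cycle, unless that arc is C minus the single vertex C[p₄]; then the 4-cycle
  -- x C[p₃] C[p₄] C[0] with chord xC[p₄] is shorter.
  module FourNeighbours (p : ℕ) (p<ℓ : p < ℓQ) (5≤ℓ : 5 ≤ ℓC) (p₁ p₂ p₃ p₄ : ℕ)
    (p₁<p₂ : p₁ < p₂) (p₂<p₃ : p₂ < p₃) (p₃<p₄ : p₃ < p₄) (p₄<ℓ : p₄ < ℓC)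
    (x₁ : adj Q[ p ] C[ p₁ ] ≡ true) (x₂ : adj Q[ p ] C[ p₂ ] ≡ true)
    (x₃ : adj Q[ p ] C[ p₃ ] ≡ true) (x₄ : adj Q[ p ] C[ p₄ ] ≡ true) where

    x : Fin n
    x = Q[ p ]
    p₃<ℓ : p₃ < ℓC
    p₃<ℓ = <-trans p₃<p₄ p₄<ℓ
    p₁<p₃ : p₁ < p₃
    p₁<p₃ = <-trans p₁<p₂ p₂<p₃
    p₁<ℓ : p₁ < ℓC
    p₁<ℓ = <-trans p₁<p₃ p₃<ℓ

    C≢x : ∀ r → r < ℓC → C[ r ] ≢ x
    C≢x r r<ℓ = C≢Q r p r<ℓ p<ℓ

    arc-shorter : suc (suc (p₃ ∸ p₁)) < ℓC → ⊥
    arc-shorter shorter = no-shorter (proj₁ fan) supported shorter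
      where
      arc : ℕPath
      arc = segment C-path p₁ p₃ (<⇒≤ p₁<p₃) p₃<ℓ
      arc-off : ∀ i → i < ℓ arc → at arc i ≢ x
      arc-off i l = C≢x (p₁ + i) (≤-<-trans (subst (p₁ + i ≤_) (m+[n∸m]≡n (<⇒≤ p₁<p₃)) (+-monoʳ-≤ p₁ (≤-pred l))) p₃<ℓ)
      fan : Σ (ChordedCycle adj) λ A → Spans A (λ z → z ≡ x ⊎ OnPath arc z)
      fan = fan-cycle arc x (s≤s (m<n⇒0<n∸m p₁<p₃)) arc-off
              (subst (λ t → adj x C[ t ] ≡ true) (sym (+-identityʳ p₁)) x₁)
              (subst (λ t → adj x C[ t ] ≡ true) (sym (m+[n∸m]≡n (<⇒≤ p₁<p₃))) x₃)
              (p₂ ∸ p₁) (m<n⇒0<n∸m p₁<p₂) (s≤s (∸-monoˡ-< p₂<p₃ (<⇒≤ p₁<p₂)))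
              (subst (λ t → adj x C[ t ] ≡ true) (sym (m+[n∸m]≡n (<⇒≤ p₁<p₂))) x₂)
      supported : Supported (proj₁ fan) (λ _ → ⊤) (_≡ p)
      supported z z∈ with proj₂ fan z z∈
      ... | inj₁ e = inj₂ (p , refl , p<ℓ , sym e)
      ... | inj₂ on with OnPath-segment C-path p₁ p₃ (<⇒≤ p₁<p₃) p₃<ℓ z on
      ...   | t , _ , t≤p₃ , e = inj₁ (t , tt , ≤-<-trans t≤p₃ p₃<ℓ , e)

    wrap-shorter : p₁ ≡ 0 → ¬ (suc (suc p₃) < ℓC) → ⊥
    wrap-shorter p₁≡0 long = no-shorter (proj₁ dia) supported (≤-<-trans (s≤s (s≤s (s≤s (s≤s z≤n)))) 5≤ℓ)
      where
      ℓ≤ : ℓC ≤ suc (suc p₃)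
      ℓ≤ = ≮⇒≥ long
      p₄≡ : p₄ ≡ suc p₃
      p₄≡ = ≤-antisym (≤-pred (≤-trans p₄<ℓ ℓ≤)) p₃<p₄
      p₄-last : suc p₄ ≡ ℓC
      p₄-last = ≤-antisym p₄<ℓ (subst (λ t → ℓC ≤ suc t) (sym p₄≡) ℓ≤)
      0<ℓ : 0 < ℓC
      0<ℓ = subst (_< ℓC) p₁≡0 p₁<ℓ
      0<p₃ : 0 < p₃
      0<p₃ = subst (_< p₃) p₁≡0 p₁<p₃
      dia : Σ (ChordedCycle adj) λ A → Spans A (λ z → z ≡ x ⊎ z ≡ C[ p₃ ] ⊎ z ≡ C[ p₄ ] ⊎ z ≡ C[ 0 ])
      dia = diamond x C[ p₃ ] C[ p₄ ] C[ 0 ] (C≢x p₃ p₃<ℓ) (C≢x p₄ p₄<ℓ) (C≢x 0 0<ℓ)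
              (C-distinct p₄ p₃ p₄<ℓ p₃<ℓ (λ e → <-irrefl (sym e) p₃<p₄))
              (C-distinct 0 p₃ 0<ℓ p₃<ℓ (λ e → <-irrefl e 0<p₃))
              (C-distinct 0 p₄ 0<ℓ p₄<ℓ (λ e → <-irrefl e (<-trans 0<p₃ p₃<p₄)))
              x₃ (C-adj p₃ p₄ p₃<ℓ p₄<ℓ (subst (λ t → consecB ℓC p₃ t ≡ true) (sym p₄≡) (consec-succ ℓC p₃)))
              (C-adj p₄ 0 p₄<ℓ 0<ℓ (consec-wrap ℓC p₄ p₄-last)) (subst (λ t → adj x C[ t ] ≡ true) p₁≡0 x₁) x₄
      supported : Supported (proj₁ dia) (λ _ → ⊤) (_≡ p)
      supported z z∈ with proj₂ dia z z∈
      ... | inj₁ e = inj₂ (p , refl , p<ℓ , sym e)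
      ... | inj₂ (inj₁ e) = inj₁ (p₃ , tt , p₃<ℓ , sym e)
      ... | inj₂ (inj₂ (inj₁ e)) = inj₁ (p₄ , tt , p₄<ℓ , sym e)
      ... | inj₂ (inj₂ (inj₂ e)) = inj₁ (0 , tt , 0<ℓ , sym e)

    absurd : ⊥
    absurd = by-first p₁ refl
      where
      by-first : ∀ t → p₁ ≡ t → ⊥
      by-first (suc a) p₁≡ = arc-shorter (subst (λ t → suc (suc (p₃ ∸ t)) < ℓC) (sym p₁≡) arc<ℓ)
        where
        -- p₃ - (a + 1) + 2 ≤ p₃ + 1 ≤ p₄ < |C|
        arc<ℓ : suc (suc (p₃ ∸ suc a)) < ℓC
        arc<ℓ = ≤-trans (s≤s (≤-<-trans (reflect< (<-trans (n<1+n a) (subst (_< p₃) p₁≡ p₁<p₃))) p₃<p₄)) p₄<ℓ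
      by-first zero p₁≡ with suc (suc p₃) <? ℓC
      ... | yes short = arc-shorter (subst (λ t → suc (suc (p₃ ∸ t)) < ℓC) (sym p₁≡) short)
      ... | no long = wrap-shorter p₁≡ long

  deg-C≤3 : ℓC ≢ 4 → ∀ p → p < ℓQ → deg-C p ≤ 3
  deg-C≤3 ℓ≢4 p p<ℓ with ℓC ≤? 3
  ... | yes ℓ≤3 = ≤-trans (count≤ _ ℓC) ℓ≤3
  ... | no ℓ≰3 = ≤-pred (≰⇒> four-absurd)
    where
    g : ℕ → Bool
    g = λ r → adj Q[ p ] C[ r ]
    5≤ℓ : 5 ≤ ℓC
    5≤ℓ = ≤∧≢⇒< (≰⇒> ℓ≰3) (λ e → ℓ≢4 (sym e))
    four-absurd : ¬ (4 ≤ deg-C p)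
    four-absurd four with last-hit g ℓC 3 four
    ... | p₄ , p₄<ℓ , x₄ , three with last-hit g p₄ 2 three
    ... | p₃ , p₃<p₄ , x₃ , two with last-hit g p₃ 1 two
    ... | p₂ , p₂<p₃ , x₂ , one with last-hit g p₂ 0 one
    ... | p₁ , p₁<p₂ , x₁ , _ = FourNeighbours.absurd p p<ℓ 5≤ℓ p₁ p₂ p₃ p₄ p₁<p₂ p₂<p₃ p₃<p₄ p₄<ℓ x₁ x₂ x₃ x₄

  module Square (ℓ≡4 : ℓC ≡ 4) where

    to01 to23 : ℕ → ℕ
    to01 p = hit p 0 + hit p 1
    to23 p = hit p 2 + hit p 3

    deg-split : ∀ p → deg-C p ≡ to01 p + to23 p
    deg-split p = trans (cong (ΣN (hit p)) ℓ≡4) (regroup (hit p 0) (hit p 1) (hit p 2) (hit p 3))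
      where
      regroup : ∀ a b c d → 0 + a + b + c + d ≡ (a + b) + (c + d)
      regroup = solve-∀

    to01≤2 : ∀ p → to01 p ≤ 2
    to01≤2 p = +-mono-≤ (b2n≤1 (adj Q[ p ] C[ 0 ])) (b2n≤1 (adj Q[ p ] C[ 1 ]))
    to23≤2 : ∀ p → to23 p ≤ 2
    to23≤2 p = +-mono-≤ (b2n≤1 (adj Q[ p ] C[ 2 ])) (b2n≤1 (adj Q[ p ] C[ 3 ]))

    <4⇒<ℓ : ∀ {i} → i < 4 → i < ℓC
    <4⇒<ℓ l = subst (_ <_) (sym ℓ≡4) l

    C01 : adj C[ 0 ] C[ 1 ] ≡ true
    C01 = C-adj 0 1 (<4⇒<ℓ (s≤s z≤n)) (<4⇒<ℓ (s≤s (s≤s z≤n))) (consec-succ ℓC 0)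
    C23 : adj C[ 2 ] C[ 3 ] ≡ true
    C23 = C-adj 2 3 (<4⇒<ℓ (s≤s (s≤s (s≤s z≤n)))) (<4⇒<ℓ ≤-refl) (consec-succ ℓC 2)

    c01∩c23=∅ : ∀ t → (t ≡ 0 ⊎ t ≡ 1) → (t ≡ 2 ⊎ t ≡ 3) → ⊥
    c01∩c23=∅ t (inj₁ refl) (inj₁ ())
    c01∩c23=∅ t (inj₁ refl) (inj₂ ())
    c01∩c23=∅ t (inj₂ refl) (inj₁ ())
    c01∩c23=∅ t (inj₂ refl) (inj₂ ())

    -- (swap) for p₁ < p₂ < p₃ < p₄: the pairs {p₁,p₂} and {p₃,p₄} cannot send ≥ 3 edges to
    -- c₀c₁ and to c₂c₃ respectively (nor the reverse); the segments [p₁,p₂] and [p₃,p₄] of Q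
    -- would carry two disjoint chorded cycles
    module Increasing (p₁ p₂ p₃ p₄ : ℕ) (p₁<p₂ : p₁ < p₂) (p₂<p₃ : p₂ < p₃) (p₃<p₄ : p₃ < p₄) (p₄<ℓ : p₄ < ℓQ) where
      p₂<ℓ : p₂ < ℓQ
      p₂<ℓ = <-trans p₂<p₃ (<-trans p₃<p₄ p₄<ℓ)

      segments-disjoint : ∀ t → (p₁ ≤ t × t ≤ p₂) → (p₃ ≤ t × t ≤ p₄) → ⊥
      segments-disjoint t (_ , t≤p₂) (p₃≤t , _) = <-irrefl refl (≤-<-trans (≤-trans p₃≤t t≤p₂) p₂<p₃)

      light : ∀ r s → (∀ t → (t ≡ r ⊎ t ≡ suc r) → (t ≡ s ⊎ t ≡ suc s) → ⊥) →
        r < 4 → suc r < 4 → s < 4 → suc s < 4 → adj C[ r ] C[ suc r ] ≡ true → adj C[ s ] C[ suc s ] ≡ true →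
        (hit p₁ r + hit p₁ (suc r)) + (hit p₂ r + hit p₂ (suc r)) ≤ 2 ⊎
        (hit p₃ s + hit p₃ (suc s)) + (hit p₄ s + hit p₄ (suc s)) ≤ 2
      light r s disjoint r<4 r+1<4 s<4 s+1<4 Crr' Css' with 3 ≤? (hit p₁ r + hit p₁ (suc r)) + (hit p₂ r + hit p₂ (suc r))
                                                         | 3 ≤? (hit p₃ s + hit p₃ (suc s)) + (hit p₄ s + hit p₄ (suc s))
      ... | no x≱3 | _ = inj₁ (at-most-two _ x≱3)
      ... | yes _ | no y≱3 = inj₂ (at-most-two _ y≱3)
      ... | yes x≥3 | yes y≥3 = ⊥-elim (no-two-disjoint (proj₁ first) (proj₁ second) (proj₂ first) (proj₂ second)
                                          disjoint segments-disjoint)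
        where
        first : Σ (ChordedCycle adj) λ A → Supported A (λ t → t ≡ r ⊎ t ≡ suc r) (λ t → p₁ ≤ t × t ≤ p₂)
        first = heavy-edge-cycle p₁ p₂ r (suc r) p₁<p₂ p₂<ℓ (<4⇒<ℓ r<4) (<4⇒<ℓ r+1<4) (λ e → <-irrefl (sym e) ≤-refl) Crr' x≥3
        second : Σ (ChordedCycle adj) λ A → Supported A (λ t → t ≡ s ⊎ t ≡ suc s) (λ t → p₃ ≤ t × t ≤ p₄)
        second = heavy-edge-cycle p₃ p₄ s (suc s) p₃<p₄ p₄<ℓ (<4⇒<ℓ s<4) (<4⇒<ℓ s+1<4) (λ e → <-irrefl (sym e) ≤-refl) Css' y≥3

      four-terms : ∀ a b c d → a ≤ 4 → b ≤ 4 → c ≤ 4 → d ≤ 4 → (a ≤ 2 ⊎ d ≤ 2) → (b ≤ 2 ⊎ c ≤ 2) → a + b + c + d ≤ 12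
      four-terms a b c d a≤4 b≤4 c≤4 d≤4 (inj₁ a≤2) (inj₁ b≤2) = +-mono-≤ (+-mono-≤ (+-mono-≤ a≤2 b≤2) c≤4) d≤4
      four-terms a b c d a≤4 b≤4 c≤4 d≤4 (inj₁ a≤2) (inj₂ c≤2) = +-mono-≤ (+-mono-≤ (+-mono-≤ a≤2 b≤4) c≤2) d≤4
      four-terms a b c d a≤4 b≤4 c≤4 d≤4 (inj₂ d≤2) (inj₁ b≤2) = +-mono-≤ (+-mono-≤ (+-mono-≤ a≤4 b≤2) c≤4) d≤2
      four-terms a b c d a≤4 b≤4 c≤4 d≤4 (inj₂ d≤2) (inj₂ c≤2) = +-mono-≤ (+-mono-≤ (+-mono-≤ a≤4 b≤4) c≤2) d≤2

      bound : deg-C p₁ + deg-C p₂ + deg-C p₃ + deg-C p₄ ≤ 12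
      bound = subst (_≤ 12) (sym regrouped)
        (four-terms (to01 p₁ + to01 p₂) (to23 p₁ + to23 p₂) (to01 p₃ + to01 p₄) (to23 p₃ + to23 p₄)
          (+-mono-≤ (to01≤2 p₁) (to01≤2 p₂)) (+-mono-≤ (to23≤2 p₁) (to23≤2 p₂))
          (+-mono-≤ (to01≤2 p₃) (to01≤2 p₄)) (+-mono-≤ (to23≤2 p₃) (to23≤2 p₄))
          (light 0 2 c01∩c23=∅ (s≤s z≤n) (s≤s (s≤s z≤n)) (s≤s (s≤s (s≤s z≤n))) ≤-refl C01 C23)
          (light 2 0 (λ t x y → c01∩c23=∅ t y x) (s≤s (s≤s (s≤s z≤n))) ≤-refl (s≤s z≤n) (s≤s (s≤s z≤n)) C23 C01))
        where
        shuffle : ∀ u₁ v₁ u₂ v₂ u₃ v₃ u₄ v₄ →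
          (u₁ + v₁) + (u₂ + v₂) + (u₃ + v₃) + (u₄ + v₄) ≡ (u₁ + u₂) + (v₁ + v₂) + (u₃ + u₄) + (v₃ + v₄)
        shuffle = solve-∀
        regrouped : deg-C p₁ + deg-C p₂ + deg-C p₃ + deg-C p₄ ≡
          (to01 p₁ + to01 p₂) + (to23 p₁ + to23 p₂) + (to01 p₃ + to01 p₄) + (to23 p₃ + to23 p₄)
        regrouped = trans (cong₂ _+_ (cong₂ _+_ (cong₂ _+_ (deg-split p₁) (deg-split p₂)) (deg-split p₃)) (deg-split p₄))
          (shuffle (to01 p₁) (to23 p₁) (to01 p₂) (to23 p₂) (to01 p₃) (to23 p₃) (to01 p₄) (to23 p₄))

  increasing-bound : ∀ p₁ p₂ p₃ p₄ → p₁ < p₂ → p₂ < p₃ → p₃ < p₄ → p₄ < ℓQ →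
    deg-C p₁ + deg-C p₂ + deg-C p₃ + deg-C p₄ ≤ 12
  increasing-bound p₁ p₂ p₃ p₄ p₁<p₂ p₂<p₃ p₃<p₄ p₄<ℓ with ℓC ≟ 4
  ... | yes ℓ≡4 = Square.Increasing.bound ℓ≡4 p₁ p₂ p₃ p₄ p₁<p₂ p₂<p₃ p₃<p₄ p₄<ℓ
  ... | no ℓ≢4 = +-mono-≤ (+-mono-≤ (+-mono-≤ (deg-C≤3 ℓ≢4 p₁ p₁<ℓ) (deg-C≤3 ℓ≢4 p₂ p₂<ℓ)) (deg-C≤3 ℓ≢4 p₃ p₃<ℓ))
                          (deg-C≤3 ℓ≢4 p₄ p₄<ℓ)
    where
    p₃<ℓ : p₃ < ℓQ
    p₃<ℓ = <-trans p₃<p₄ p₄<ℓ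
    p₂<ℓ : p₂ < ℓQ
    p₂<ℓ = <-trans p₂<p₃ p₃<ℓ
    p₁<ℓ : p₁ < ℓQ
    p₁<ℓ = <-trans p₁<p₂ p₂<ℓ

  edgesTo-as-count : ∀ x → edgesTo x C ≡ count (λ r → adj x C[ r ]) ℓC
  edgesTo-as-count x = ΣFin-as-ΣN ℓC _ _ (λ i → cong (λ z → b2n (adj x z)) (extend-toℕ ℓC C≢∅ (vert (cyc C)) i))

  position : ∀ {x} → x ∈P Q → Σ ℕ λ p → p < ℓQ × edgesTo x C ≡ deg-C p
  position (i , e) = toℕ i , toℕ<n i ,
    trans (cong (λ z → edgesTo z C) (trans (sym e) (extend-toℕ ℓQ Q≢∅ (pvert Q) i))) (edgesTo-as-count _)

  distinct-positions : ∀ {x y} (x∈ : x ∈P Q) (y∈ : y ∈P Q) → x ≢ y → proj₁ (position x∈) ≢ proj₁ (position y∈)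
  distinct-positions (i , ei) (j , ej) x≢y e = x≢y (trans (sym ei) (trans (cong (pvert Q) (toℕ-injective e)) ej))

  four-vertices-bound : (F : List (Fin n)) → Unique F → length F ≡ 4 → All (_∈P Q) F → edgesSet F C ≤ 12
  four-vertices-bound (a ∷ b ∷ c ∷ d ∷ []) ((a≢b ∷ a≢c ∷ a≢d ∷ []) ∷ (b≢c ∷ b≢d ∷ []) ∷ (c≢d ∷ []) ∷ [] ∷ []) refl
                      (a∈ ∷ b∈ ∷ c∈ ∷ d∈ ∷ []) =
    subst (_≤ 12) (sym (cong₂ _+_ (degree a∈) (cong₂ _+_ (degree b∈) (cong₂ _+_ (degree c∈) (cong (_+ 0) (degree d∈))))))
      (FourPositions.any-order deg-C ℓQ 12 increasing-bound (pos a∈) (pos b∈) (pos c∈) (pos d∈)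
        (distinct-positions a∈ b∈ a≢b) (distinct-positions a∈ c∈ a≢c) (distinct-positions a∈ d∈ a≢d)
        (distinct-positions b∈ c∈ b≢c) (distinct-positions b∈ d∈ b≢d) (distinct-positions c∈ d∈ c≢d)
        (bnd a∈) (bnd b∈) (bnd c∈) (bnd d∈))
    where
    pos : ∀ {x} → x ∈P Q → ℕ
    pos x∈ = proj₁ (position x∈)
    bnd : ∀ {x} (x∈ : x ∈P Q) → pos x∈ < ℓQ
    bnd x∈ = proj₁ (proj₂ (position x∈))
    degree : ∀ {x} (x∈ : x ∈P Q) → edgesTo x C ≡ deg-C (pos x∈)
    degree x∈ = proj₂ (proj₂ (position x∈))

  module EndpointK4 (ℓ≡4 : ℓC ≡ 4) (K4 : ∀ a b → a < ℓC → b < ℓC → a ≢ b → adj C[ a ] C[ b ] ≡ true)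
    (e : ℕ) (e<ℓ : e < ℓQ) where

    open Square ℓ≡4 using (deg-split; <4⇒<ℓ)

    v : Fin n
    v = Q[ e ]

    triangle-cycle : ∀ a b c → a < ℓC → b < ℓC → c < ℓC → a ≢ b → a ≢ c → b ≢ c →
      adj v C[ a ] ≡ true → adj v C[ b ] ≡ true →
      Σ (ChordedCycle adj) λ A → Supported A (λ t → t ≡ a ⊎ t ≡ b ⊎ t ≡ c) (_≡ e)
    triangle-cycle a b c a<ℓ b<ℓ c<ℓ a≢b a≢c b≢c va vb = proj₁ dia , supported
      where
      dia : Σ (ChordedCycle adj) λ A → Spans A (λ z → z ≡ C[ a ] ⊎ z ≡ v ⊎ z ≡ C[ b ] ⊎ z ≡ C[ c ])
      dia = diamond C[ a ] v C[ b ] C[ c ] (λ x → C≢Q a e a<ℓ e<ℓ (sym x))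
              (C-distinct b a b<ℓ a<ℓ (λ x → a≢b (sym x))) (C-distinct c a c<ℓ a<ℓ (λ x → a≢c (sym x)))
              (λ x → C≢Q b e b<ℓ e<ℓ x) (λ x → C≢Q c e c<ℓ e<ℓ x) (C-distinct c b c<ℓ b<ℓ (λ x → b≢c (sym x)))
              (flip va) vb (K4 b c b<ℓ c<ℓ b≢c) (K4 a c a<ℓ c<ℓ a≢c) (K4 a b a<ℓ b<ℓ a≢b)
      supported : Supported (proj₁ dia) (λ t → t ≡ a ⊎ t ≡ b ⊎ t ≡ c) (_≡ e)
      supported z z∈ with proj₂ dia z z∈
      ... | inj₁ x = inj₁ (a , inj₁ refl , a<ℓ , sym x)
      ... | inj₂ (inj₁ x) = inj₂ (e , refl , e<ℓ , sym x)
      ... | inj₂ (inj₂ (inj₁ x)) = inj₁ (b , inj₂ (inj₁ refl) , b<ℓ , sym x)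
      ... | inj₂ (inj₂ (inj₂ x)) = inj₁ (c , inj₂ (inj₂ refl) , c<ℓ , sym x)

    two-of-triangle-cycle : ∀ j k l → j < ℓC → k < ℓC → l < ℓC → j ≢ k → j ≢ l → k ≢ l →
      2 ≤ hit e j + hit e k + hit e l →
      Σ (ChordedCycle adj) λ A → Supported A (λ t → t ≡ j ⊎ t ≡ k ⊎ t ≡ l) (_≡ e)
    two-of-triangle-cycle j k l j<ℓ k<ℓ l<ℓ j≢k j≢l k≢l two
      with two-of-three (adj v C[ j ]) (adj v C[ k ]) (adj v C[ l ]) two
    ... | inj₁ (vj , vk) = triangle-cycle j k l j<ℓ k<ℓ l<ℓ j≢k j≢l k≢l vj vk
    ... | inj₂ (inj₁ (vj , vl)) with triangle-cycle j l k j<ℓ l<ℓ k<ℓ j≢l j≢k (λ x → k≢l (sym x)) vj vl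
    ...   | A , sA = A , Supported-mono A (λ { t (inj₁ x) → inj₁ x ; t (inj₂ (inj₁ x)) → inj₂ (inj₂ x)
                                             ; t (inj₂ (inj₂ x)) → inj₂ (inj₁ x) }) (λ t x → x) sA
    two-of-triangle-cycle j k l j<ℓ k<ℓ l<ℓ j≢k j≢l k≢l two | inj₂ (inj₂ (vk , vl))
      with triangle-cycle k l j k<ℓ l<ℓ j<ℓ k≢l (λ x → j≢k (sym x)) (λ x → j≢l (sym x)) vk vl
    ...   | A , sA = A , Supported-mono A (λ { t (inj₁ x) → inj₂ (inj₁ x) ; t (inj₂ (inj₁ x)) → inj₂ (inj₂ x)
                                             ; t (inj₂ (inj₂ x)) → inj₁ x }) (λ t x → x) sA

    two-outside : 3 ≤ deg-C e →
      (2 ≤ hit e 1 + hit e 2 + hit e 3) × (2 ≤ hit e 0 + hit e 2 + hit e 3) ×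
      (2 ≤ hit e 0 + hit e 1 + hit e 3) × (2 ≤ hit e 0 + hit e 1 + hit e 2)
    two-outside three = drop-one (hit e 0) _ (b2n≤1 _) (subst (3 ≤_) (without-0 h₀ h₁ h₂ h₃) three') ,
                        drop-one (hit e 1) _ (b2n≤1 _) (subst (3 ≤_) (without-1 h₀ h₁ h₂ h₃) three') ,
                        drop-one (hit e 2) _ (b2n≤1 _) (subst (3 ≤_) (without-2 h₀ h₁ h₂ h₃) three') ,
                        drop-one (hit e 3) _ (b2n≤1 _) (subst (3 ≤_) (without-3 h₀ h₁ h₂ h₃) three')
      where
      h₀ h₁ h₂ h₃ : ℕ
      h₀ = hit e 0
      h₁ = hit e 1
      h₂ = hit e 2
      h₃ = hit e 3
      three' : 3 ≤ (h₀ + h₁) + (h₂ + h₃)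
      three' = subst (3 ≤_) (deg-split e) three
      without-0 : ∀ a b c d → (a + b) + (c + d) ≡ a + (b + c + d)
      without-0 = solve-∀
      without-1 : ∀ a b c d → (a + b) + (c + d) ≡ b + (a + c + d)
      without-1 = solve-∀
      without-2 : ∀ a b c d → (a + b) + (c + d) ≡ c + (a + b + d)
      without-2 = solve-∀
      without-3 : ∀ a b c d → (a + b) + (c + d) ≡ d + (a + b + c)
      without-3 = solve-∀

    -- Q - v is the path Q[s] … Q[s+m-1], lying on one side of e
    module Rest (s m : ℕ) (split : ∀ f → ΣN f ℓQ ≡ f e + ΣN (λ i → f (s + i)) m) (s+m≤ℓ : s + m ≤ ℓQ)
      (one-side : ∀ i j → i ≤ j → j < m → e < s + i ⊎ s + j < e) where

      hits : ℕ → ℕ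
      hits r = count (λ i → adj Q[ s + i ] C[ r ]) m

      -- (swap) If v sees two of the other vertices C[j], C[k], C[l], then C[r] has at most
      -- two neighbours on Q - v: three would close a segment of Q - v into a chorded cycle,
      -- disjoint from the one v spans with C[j], C[k], C[l].
      few-hits : ∀ r j k l → r < ℓC → j < ℓC → k < ℓC → l < ℓC → r ≢ j → r ≢ k → r ≢ l →
        j ≢ k → j ≢ l → k ≢ l → 2 ≤ hit e j + hit e k + hit e l → hits r ≤ 2
      few-hits r j k l r<ℓ j<ℓ k<ℓ l<ℓ r≢j r≢k r≢l j≢k j≢l k≢l two = at-most-two (hits r) three-absurd
        where
        g : ℕ → Bool
        g = λ i → adj Q[ s + i ] C[ r ]
        three-absurd : ¬ (3 ≤ hits r)
        three-absurd three with last-hit g m 2 three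
        ... | i₃ , i₃<m , r₃ , two' with last-hit g i₃ 1 two'
        ... | i₂ , i₂<i₃ , r₂ , one with last-hit g i₂ 0 one
        ... | i₁ , i₁<i₂ , r₁ , _ = no-two-disjoint (proj₁ fan) (proj₁ tri) (proj₂ fan) (proj₂ tri) C-apart Q-apart
          where
          fan : Σ (ChordedCycle adj) λ A → Supported A (_≡ r) (λ t → s + i₁ ≤ t × t ≤ s + i₃)
          fan = three-neighbours-cycle r (s + i₁) (s + i₂) (s + i₃) (+-monoʳ-< s i₁<i₂) (+-monoʳ-< s i₂<i₃)
                  (≤-trans (+-monoʳ-< s i₃<m) s+m≤ℓ) r<ℓ (flip r₁) (flip r₂) (flip r₃)
          tri : Σ (ChordedCycle adj) λ A → Supported A (λ t → t ≡ j ⊎ t ≡ k ⊎ t ≡ l) (_≡ e)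
          tri = two-of-triangle-cycle j k l j<ℓ k<ℓ l<ℓ j≢k j≢l k≢l two
          C-apart : ∀ t → t ≡ r → (t ≡ j ⊎ t ≡ k ⊎ t ≡ l) → ⊥
          C-apart t refl (inj₁ x) = r≢j x
          C-apart t refl (inj₂ (inj₁ x)) = r≢k x
          C-apart t refl (inj₂ (inj₂ x)) = r≢l x
          Q-apart : ∀ t → (s + i₁ ≤ t × t ≤ s + i₃) → t ≡ e → ⊥
          Q-apart t (lo , hi) refl with one-side i₁ i₃ (<⇒≤ (<-trans i₁<i₂ i₂<i₃)) i₃<m
          ... | inj₁ x = <-irrefl refl (<-≤-trans x lo)
          ... | inj₂ x = <-irrefl refl (≤-<-trans hi x)

      total : ΣN deg-C ℓQ ≡ deg-C e + ((hits 0 + hits 1) + (hits 2 + hits 3))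
      total = begin
        ΣN deg-C ℓQ
          ≡⟨ ΣN-cong deg-C _ ℓQ (λ p _ → deg-split p) ⟩
        ΣN (λ p → (hit p 0 + hit p 1) + (hit p 2 + hit p 3)) ℓQ
          ≡⟨ ΣN-+ (λ p → hit p 0 + hit p 1) (λ p → hit p 2 + hit p 3) ℓQ ⟩
        ΣN (λ p → hit p 0 + hit p 1) ℓQ + ΣN (λ p → hit p 2 + hit p 3) ℓQ
          ≡⟨ cong₂ _+_ (ΣN-+ (λ p → hit p 0) (λ p → hit p 1) ℓQ) (ΣN-+ (λ p → hit p 2) (λ p → hit p 3) ℓQ) ⟩
        (column 0 + column 1) + (column 2 + column 3)
          ≡⟨ cong₂ _+_ (cong₂ _+_ (split (λ p → hit p 0)) (split (λ p → hit p 1)))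
                       (cong₂ _+_ (split (λ p → hit p 2)) (split (λ p → hit p 3))) ⟩
        ((hit e 0 + hits 0) + (hit e 1 + hits 1)) + ((hit e 2 + hits 2) + (hit e 3 + hits 3))
          ≡⟨ shuffle (hit e 0) (hit e 1) (hit e 2) (hit e 3) (hits 0) (hits 1) (hits 2) (hits 3) ⟩
        ((hit e 0 + hit e 1) + (hit e 2 + hit e 3)) + ((hits 0 + hits 1) + (hits 2 + hits 3))
          ≡⟨ cong (_+ ((hits 0 + hits 1) + (hits 2 + hits 3))) (sym (deg-split e)) ⟩
        deg-C e + ((hits 0 + hits 1) + (hits 2 + hits 3)) ∎
        where
        open ≡-Reasoning
        column : ℕ → ℕ
        column r = ΣN (λ p → hit p r) ℓQ
        shuffle : ∀ d₀ d₁ d₂ d₃ n₀ n₁ n₂ n₃ → ((d₀ + n₀) + (d₁ + n₁)) + ((d₂ + n₂) + (d₃ + n₃)) ≡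
                                             ((d₀ + d₁) + (d₂ + d₃)) + ((n₀ + n₁) + (n₂ + n₃))
        shuffle = solve-∀

      -- ‖V(Q), C‖ ≤ 4 + 4·2, with equality only if ‖v, C‖ = 4
      bound : 3 ≤ deg-C e → ΣN deg-C ℓQ ≤ 12 × (ΣN deg-C ℓQ ≡ 12 → deg-C e ≡ 4)
      bound three = subst (_≤ 12) (sym total) (+-mono-≤ v≤4 rest≤8) ,
                    λ total≡12 → ≤-antisym v≤4 (4≤v (trans (sym total) total≡12))
        where
        L0 : 0 < ℓC
        L0 = <4⇒<ℓ (s≤s z≤n)
        L1 : 1 < ℓC
        L1 = <4⇒<ℓ (s≤s (s≤s z≤n))
        L2 : 2 < ℓC
        L2 = <4⇒<ℓ (s≤s (s≤s (s≤s z≤n)))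
        L3 : 3 < ℓC
        L3 = <4⇒<ℓ ≤-refl
        outside : (2 ≤ hit e 1 + hit e 2 + hit e 3) × (2 ≤ hit e 0 + hit e 2 + hit e 3) ×
          (2 ≤ hit e 0 + hit e 1 + hit e 3) × (2 ≤ hit e 0 + hit e 1 + hit e 2)
        outside = two-outside three
        rest≤8 : (hits 0 + hits 1) + (hits 2 + hits 3) ≤ 8
        rest≤8 = +-mono-≤
          (+-mono-≤ (few-hits 0 1 2 3 L0 L1 L2 L3 (λ ()) (λ ()) (λ ()) (λ ()) (λ ()) (λ ()) (proj₁ outside))
                    (few-hits 1 0 2 3 L1 L0 L2 L3 (λ ()) (λ ()) (λ ()) (λ ()) (λ ()) (λ ()) (proj₁ (proj₂ outside))))
          (+-mono-≤ (few-hits 2 0 1 3 L2 L0 L1 L3 (λ ()) (λ ()) (λ ()) (λ ()) (λ ()) (λ ()) (proj₁ (proj₂ (proj₂ outside))))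
                    (few-hits 3 0 1 2 L3 L0 L1 L2 (λ ()) (λ ()) (λ ()) (λ ()) (λ ()) (λ ()) (proj₂ (proj₂ (proj₂ outside)))))
        v≤4 : deg-C e ≤ 4
        v≤4 = subst (deg-C e ≤_) ℓ≡4 (count≤ _ ℓC)
        4≤v : deg-C e + ((hits 0 + hits 1) + (hits 2 + hits 3)) ≡ 12 → 4 ≤ deg-C e
        4≤v sum≡12 = +-cancelʳ-≤ 8 4 (deg-C e) (subst (_≤ deg-C e + 8) sum≡12 (+-monoʳ-≤ (deg-C e) rest≤8))

    endpoint-bound : (e ≡ 0 ⊎ suc e ≡ ℓQ) → 3 ≤ deg-C e → ΣN deg-C ℓQ ≤ 12 × (ΣN deg-C ℓQ ≡ 12 → deg-C e ≡ 4)
    endpoint-bound (inj₁ e≡0) = Rest.bound 1 (ℓQ ∸ 1) split (≤-reflexive (m+[n∸m]≡n Q≢∅))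
      (λ i _ _ _ → inj₁ (subst (_< suc i) (sym e≡0) (s≤s z≤n)))
      where
      split : ∀ f → ΣN f ℓQ ≡ f e + ΣN (λ t → f (1 + t)) (ℓQ ∸ 1)
      split f = trans (cong (ΣN f) (sym (m+[n∸m]≡n Q≢∅)))
                (trans (ΣN-front f (ℓQ ∸ 1)) (cong (λ t → f t + ΣN (λ t → f (suc t)) (ℓQ ∸ 1)) (sym e≡0)))
    endpoint-bound (inj₂ e-last) = Rest.bound 0 e split (<⇒≤ e<ℓ) (λ _ _ _ j<e → inj₂ j<e)
      where
      split : ∀ f → ΣN f ℓQ ≡ f e + ΣN (λ t → f (0 + t)) e
      split f = trans (cong (ΣN f) (sym e-last)) (+-comm (ΣN f e) (f e))

  endpoint-path-bound : InducesK4 C → (v : Fin n) → Endpoint Q v → edgesTo v C ≥ 3 →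
    edgesPath Q C ≤ 12 × (edgesPath Q C ≡ 12 → edgesTo v C ≡ 4)
  endpoint-path-bound (ℓ≡4 , K4) v (i , end , i↦v) three =
    subst (_≤ 12) (sym path-sum) (proj₁ bounds) , λ sum≡12 → trans v-deg (proj₂ bounds (trans (sym path-sum) sum≡12))
    where
    v-deg : edgesTo v C ≡ deg-C (toℕ i)
    v-deg = proj₂ (proj₂ (position (i , i↦v)))
    K4' : ∀ a b → a < ℓC → b < ℓC → a ≢ b → adj C[ a ] C[ b ] ≡ true
    K4' a b a<ℓ b<ℓ a≢b = subst₂ (λ x y → adj x y ≡ true)
      (sym (extend-eq ℓC C≢∅ (vert (cyc C)) a a<ℓ)) (sym (extend-eq ℓC C≢∅ (vert (cyc C)) b b<ℓ))
      (K4 (fromℕ< a<ℓ) (fromℕ< b<ℓ) (λ x → a≢b (trans (sym (toℕ-fromℕ< a<ℓ)) (trans (cong toℕ x) (toℕ-fromℕ< b<ℓ)))))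
    path-sum : edgesPath Q C ≡ ΣN deg-C ℓQ
    path-sum = ΣFin-as-ΣN ℓQ (λ i → edgesTo (pvert Q i) C) deg-C (λ i → proj₂ (proj₂ (position (i , refl))))
    bounds : ΣN deg-C ℓQ ≤ 12 × (ΣN deg-C ℓQ ≡ 12 → deg-C (toℕ i) ≡ 4)
    bounds = EndpointK4.endpoint-bound ℓ≡4 K4' (toℕ i) (toℕ<n i) end (subst (3 ≤_) v-deg three)

lemma14 : (k n : ℕ) → k ≥ 2 → n ≥ 4 * k →
    (adj : Adjacency n) →
    (∀ x y → adj x y ≡ adj y x) → (∀ x → adj x x ≡ false) →
    Sigma2≥ adj (6 * k ∸ 2) →
    ¬ HasDisjointChordedCycles adj k →
    (∀ x y → x ≢ y → adj x y ≡ false → HasDisjointChordedCycles (addEdge adj x y) k) →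
    (𝒞 : Collection adj (k ∸ 1)) → O1 𝒞 → O2 𝒞 → O3 𝒞 →
    (Q : Path adj) → PathIn 𝒞 Q → plen Q ≥ 4 →
    (C : ChordedCycle adj) → C ∈ cycles 𝒞 →
    ((F : List (Fin n)) → Unique F → length F ≡ 4 → All (λ x → x ∈P Q) F →
       edgesSet F C ≤ 12)
    ×
    (InducesK4 C → (v : Fin n) → Endpoint Q v → edgesTo v C ≥ 3 →
       edgesPath Q C ≤ 12 × (edgesPath Q C ≡ 12 → edgesTo v C ≡ 4))
lemma14 k n k≥2 _ adj adj-sym _ _ no-k-cycles _ 𝒞 o1 _ _ Q Q-in-R |Q|≥4 C C∈𝒞 =
  four-vertices-bound , endpoint-path-bound
  where
  open Frame k n k≥2 adj adj-sym no-k-cycles 𝒞 o1 Q Q-in-R (≤-trans (s≤s z≤n) |Q|≥4) C C∈𝒞
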